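{- Let $G$ be a connected plabic graph. Then $G$ can be transformed using only tail removal into: a graph consisting of a single edge joining two boundary vertices, if $G$ has no interior faces; a graph consisting of one boundary vertex joined to an interior vertex (of either color) that is incident to a loop edge, if $G$ has exactly one interior face; a plabic graph with no boundary vertices, if $G$ has two or more interior faces.
   Context: A plabic graph $G$ is a nonempty finite planar graph embedded in a closed disk, with $N\ge0$ boundary vertices on the boundary circle, each of degree 1 and labeled $1,\dots,N$ clockwise, and interior vertices colored black or white; each interior vertex has degree 3 and each interior face (a face not adjacent to the boundary circle) is simply connected. Tail removal: if a boundary vertex $b$ is adjacent to an interior vertex $v$ that is not incident to a loop edge, delete $b$ and the edge $bv$, and then erase the resulting degree-2 vertex $v$ by merging its two remaining edges into one edge (remaining boundary vertices are relabeled). -}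

module Defs where

-- Connected plabic graphs encoded as combinatorial maps (rotation systems).

open import Data.Nat using (ℕ; zero; suc; _+_; _*_; _∸_; _≤_; _<_; _≤ᵇ_)
open import Data.Fin using (Fin; zero; suc; toℕ)
open import Data.Bool using (Bool; true; false; if_then_else_)
open import Data.List using (List; map; _++_; allFin; cartesianProduct; upTo)
open import Data.Bool.ListAction using (all)
open import Data.Nat.ListAction using (sum)
open import Data.Product using (Σ; _×_; _,_)
open import Data.Sum using (_⊎_; inj₁; inj₂)
open import Data.Empty using (⊥)
open import Data.Unit using (⊤)
open import Function using (_∘_)
open import Relation.Nullary using (¬_)
open import Relation.Binary.PropositionalEquality using (_≡_; _≢_)
open import Relation.Binary.Construct.Closure.ReflexiveTransitive using (Star)

data Colour : Set where
  black white : Colour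

-- Darts (half-edges): one for each boundary vertex (degree 1), three for each
-- interior vertex (degree 3), the latter numbered 0,1,2 in clockwise order.
Dart : ℕ → ℕ → Set
Dart nB nI = Fin nB ⊎ (Fin nI × Fin 3)

rot : Fin 3 → Fin 3
rot zero = suc zero
rot (suc zero) = suc (suc zero)
rot (suc (suc zero)) = zero

σ : ∀ {nB nI} → Dart nB nI → Dart nB nI
σ (inj₁ b) = inj₁ b
σ (inj₂ (v , i)) = inj₂ (v , rot i)

iter : ∀ {A : Set} → (A → A) → ℕ → A → A
iter f zero x = x
iter f (suc k) x = f (iter f k x)

IsInterior : ∀ {nB nI} → Dart nB nI → Set
IsInterior (inj₁ _) = ⊥
IsInterior (inj₂ _) = ⊤

CycSucc : (n : ℕ) → Fin n → Fin n → Set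
CycSucc n b b' = (suc (toℕ b) ≡ toℕ b') ⊎ ((suc (toℕ b) ≡ n) × (toℕ b' ≡ 0))

data Reach {nB nI : ℕ} (α : Dart nB nI → Dart nB nI) :
       Dart nB nI → Dart nB nI → Set where
  here : ∀ {d} → Reach α d d
  viaα : ∀ {d e} → Reach α d e → Reach α d (α e)
  viaσ : ∀ {d e} → Reach α d e → Reach α d (σ e)

module _ {nB nI : ℕ} (α : Dart nB nI → Dart nB nI) where

  -- face permutation: traverse an edge, then turn clockwise
  φ : Dart nB nI → Dart nB nI
  φ d = σ (α d)

  numDarts : ℕ
  numDarts = nB + 3 * nI

  rank : Dart nB nI → ℕ
  rank (inj₁ b) = toℕ b
  rank (inj₂ (v , i)) = nB + (3 * toℕ v + toℕ i)

  allDarts : List (Dart nB nI)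
  allDarts = map inj₁ (allFin nB) ++ map inj₂ (cartesianProduct (allFin nI) (allFin 3))

  isFaceRep : Dart nB nI → Bool
  isFaceRep d = all (λ k → rank d ≤ᵇ rank (iter φ k d)) (upTo numDarts)

  numFaces : ℕ
  numFaces = sum (map (λ d → if isFaceRep d then 1 else 0) allDarts)

  -- Euler's formula V - E + F = 2 (genus 0), multiplied by 2 (2E = #darts)
  Planar : Set
  Planar = 2 * (nB + nI) + 2 * numFaces ≡ 4 + numDarts

  -- the boundary darts occur along one face (the outer face) in the
  -- cyclic order 1, 2, ..., nB
  BoundaryOrder : Set
  BoundaryOrder = ∀ b b' → CycSucc nB b b' →
    Σ ℕ λ k → (1 ≤ k) × (iter φ k (inj₁ b) ≡ inj₁ b') ×
      (∀ j → 1 ≤ j → j < k → IsInterior (iter φ j (inj₁ b)))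

record PlabicGraph : Set where
  field
    nB : ℕ
    nI : ℕ
    col : Fin nI → Colour
    α : Dart nB nI → Dart nB nI
    α-invol : ∀ d → α (α d) ≡ d
    α-nofix : ∀ d → α d ≢ d
    connected : ∀ d e → Reach α d e
    planar : Planar α
    boundaryOrder : BoundaryOrder α

open PlabicGraph public

-- interior faces: all faces except the outer one (the one meeting the circle)
interiorFaces : PlabicGraph → ℕ
interiorFaces G = numFaces (α G) ∸ 1

-- y is the new partner of x after erasing the degree-2 vertex v
-- (whose remaining darts are i1, i2)
Bypass : ∀ {nB nI} (α : Dart nB nI → Dart nB nI) (v : Fin nI) (i1 i2 : Fin 3) →
         Dart nB nI → Dart nB nI → Set
Bypass α v i1 i2 x y =
  ((x ≡ inj₂ (v , i1)) × (y ≡ α (inj₂ (v , i2)))) ⊎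
  ((x ≡ inj₂ (v , i2)) × (y ≡ α (inj₂ (v , i1)))) ⊎
  ((x ≢ inj₂ (v , i1)) × (x ≢ inj₂ (v , i2)) × (y ≡ x))

-- One tail removal step G ⟶ H: H is (isomorphic to) the graph obtained from G
-- by deleting the boundary vertex b, the edge b v, and erasing v.
-- g identifies the darts of H with the surviving darts of G.
record TailStep (G H : PlabicGraph) : Set where
  field
    b : Fin (nB G)
    v : Fin (nI G)
    i : Fin 3
    tail : α G (inj₁ b) ≡ inj₂ (v , i)
    noLoop : ¬ (α G (inj₂ (v , rot i)) ≡ inj₂ (v , rot (rot i)))
    g : Dart (nB H) (nI H) → Dart (nB G) (nI G)
    g-inj : ∀ d d' → g d ≡ g d' → d ≡ d'
    g-avoid-b : ∀ d → g d ≢ inj₁ b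
    g-avoid-v : ∀ d k → g d ≢ inj₂ (v , k)
    g-surj : ∀ e → e ≢ inj₁ b → (∀ k → e ≢ inj₂ (v , k)) → Σ _ λ d → g d ≡ e
    g-bdry : ∀ c → Σ (Fin (nB G)) λ c' → (g (inj₁ c) ≡ inj₁ c') ×
               (((toℕ c < toℕ b) × (toℕ c' ≡ toℕ c)) ⊎
                ((toℕ b ≤ toℕ c) × (toℕ c' ≡ suc (toℕ c))))
    g-σ : ∀ d → g (σ d) ≡ σ (g d)
    g-col : ∀ w j u k → g (inj₂ (w , j)) ≡ inj₂ (u , k) → col H w ≡ col G u
    g-α : ∀ d → Bypass (α G) v (rot i) (rot (rot i)) (α G (g d)) (g (α H d))

TailRemovals : PlabicGraph → PlabicGraph → Set
TailRemovals = Star TailStep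

SingleEdge : PlabicGraph → Set
SingleEdge H = (nB H ≡ 2) × (nI H ≡ 0) ×
  (∀ c → Σ (Fin (nB H)) λ c' → α H (inj₁ c) ≡ inj₁ c')

Lollipop : PlabicGraph → Set
Lollipop H = (nB H ≡ 1) × (nI H ≡ 1) ×
  (∀ c → Σ (Fin (nI H)) λ w → Σ (Fin 3) λ j →
     (α H (inj₁ c) ≡ inj₂ (w , j)) ×
     (α H (inj₂ (w , rot j)) ≡ inj₂ (w , rot (rot j))))

NoBoundary : PlabicGraph → Set
NoBoundary H = nB H ≡ 0

-- Induct on the number of boundary vertices, always removing the tail at boundary vertex 1.
-- A tail removal preserves all the axioms; the only non-local one is Euler's formula, which survives
-- because the number of faces does not change: the face permutation of the new graph is the
-- first-return map of the old one on the surviving darts, and deleting a point x with f x ≠ x from a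
-- permutation f (passing to the first-return map) preserves the number of cycles. Every deleted dart
-- shares a face with a surviving one, so it is never a fixed point when it is deleted.
-- Tail removal gets stuck exactly when boundary vertex 1 is joined to another boundary vertex, and then
-- by connectivity the graph is a single edge, or to an interior vertex with a loop, and then it is a
-- lollipop; otherwise it ends with no boundary vertices. Euler's formula gives 1, 2 and at least 3
-- faces in these cases, so the number of interior faces of the original graph tells which one occurs.

module Submission where

open import Defs
open import Data.Nat
  using (ℕ; zero; suc; _+_; _*_; _∸_; _≤_; _<_; _≤ᵇ_; _<?_; _≤?_; z≤n; s≤s; s≤s⁻¹; NonZero; >-nonZero)
open import Data.Nat.Properties hiding (_≟_)
open import Data.Nat.DivMod using (_%_; _/_; m≡m%n+[m/n]*n; m%n<n)
open import Data.Nat.Induction using (<-wellFounded)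
open import Induction.WellFounded using (Acc; acc)
open import Data.Fin
  using (Fin; zero; suc; toℕ; fromℕ<; punchIn; punchOut; _≟_; _↑ˡ_; _↑ʳ_; cast; combine; remQuot; splitAt; join)
open import Data.Fin.Properties
  using (toℕ-injective; pigeonhole; toℕ<n; toℕ-fromℕ<; punchIn-injective; punchInᵢ≢i; punchIn-punchOut;
         punchIn-mono-≤; punchIn-cancel-≤; toℕ-↑ˡ; toℕ-↑ʳ; toℕ-cast; cast-is-id; cast-involutive; toℕ-combine;
         splitAt-↑ˡ; splitAt-↑ʳ; join-splitAt; remQuot-combine; combine-remQuot)
open import Data.Bool using (Bool; true; false; if_then_else_; T)
open import Data.Bool.ListAction using (all; and)
open import Data.List using (_∷_; map; _++_; upTo; applyUpTo; tabulate; allFin; cartesianProduct)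
open import Data.Nat.ListAction using (sum)
open import Data.List.Properties using (map-cong; map-++; map-∘; map-injective; map-tabulate; map-applyUpTo)
open import Data.List.Relation.Unary.Any using (satisfied)
open import Data.List.Relation.Unary.All.Properties using (all⁺; all⁻; applyUpTo⁺₂; applyUpTo⁻; ¬All⇒Any¬)
open import Algebra.Properties.CommutativeMonoid.Sum +-0-commutativeMonoid using (sum-cong-≗; sum-remove) renaming (sum to ∑)
open import Data.Product using (Σ; ∃; _×_; _,_; proj₁; proj₂)
open import Data.Sum using (_⊎_; inj₁; inj₂)
import Data.Sum.Properties as Sum
import Data.Product.Properties as Product
open import Data.Unit using (tt)
open import Data.Empty.Irrelevant using () renaming (⊥-elim to ⊥-elim-irr)
open import Data.Empty using (⊥)
open import Function using (_∘_; id)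
open import Function.Definitions using (Injective)
open import Relation.Binary.PropositionalEquality
open import Relation.Binary.Construct.Closure.ReflexiveTransitive using (ε; _◅_)
open import Relation.Nullary using (¬_; yes; no; contradiction)
open import Relation.Nullary.Decidable using (T?)
open import Relation.Binary.Definitions using (tri<; tri≈; tri>; DecidableEquality)
open import Relation.Unary using (Decidable)
open import Data.Nat.Tactic.RingSolver using (solve-∀)

Injection : {A B : Set} → (A → B) → Set
Injection = Injective _≡_ _≡_

iter-+ : ∀ {A : Set} (f : A → A) m n x → iter f (m + n) x ≡ iter f m (iter f n x)
iter-+ f zero    n x = refl
iter-+ f (suc m) n x = cong f (iter-+ f m n x)

iter-sucʳ : ∀ {A : Set} (f : A → A) k x → iter f (suc k) x ≡ iter f k (f x)
iter-sucʳ f k x = trans (cong (λ m → iter f m x) (+-comm 1 k)) (iter-+ f k 1 x)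

iter-∸ : ∀ {A : Set} (f : A → A) {m n} x → n ≤ m → iter f m x ≡ iter f (m ∸ n) (iter f n x)
iter-∸ f {m} {n} x n≤m = trans (cong (λ k → iter f k x) (sym (m∸n+n≡m n≤m))) (iter-+ f (m ∸ n) n x)

iter-injective : ∀ {A : Set} {f : A → A} → Injection f → ∀ k → Injection (iter f k)
iter-injective f-inj zero    eq = eq
iter-injective f-inj (suc k) eq = iter-injective f-inj k (f-inj eq)

iter-cong : ∀ {A : Set} {f g : A → A} → f ≗ g → ∀ k → iter f k ≗ iter g k
iter-cong f≗g zero    x = refl
iter-cong {f = f} f≗g (suc k) x = trans (cong f (iter-cong f≗g k x)) (f≗g _)

iter-periodic : ∀ {A : Set} (f : A → A) {p x} → iter f p x ≡ x → ∀ a → iter f (a * p) x ≡ x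
iter-periodic f         fᵖx≡x zero    = refl
iter-periodic f {p} {x} fᵖx≡x (suc a) =
  trans (iter-+ f p (a * p) x) (trans (cong (iter f p) (iter-periodic f fᵖx≡x a)) fᵖx≡x)

sum-bump : ∀ {n} (a b : Fin n → ℕ) y₀ → a y₀ ≡ suc (b y₀) → (∀ y → y ≢ y₀ → a y ≡ b y) →
           ∑ a ≡ suc (∑ b)
sum-bump {suc n} a b y₀ a≡1+b a≡b = begin
  ∑ a                                ≡⟨ sum-remove {i = y₀} a ⟩
  a y₀ + ∑ (a ∘ punchIn y₀)          ≡⟨ cong₂ _+_ a≡1+b (sum-cong-≗ (λ z → a≡b _ (punchInᵢ≢i y₀ z))) ⟩
  suc (b y₀ + ∑ (b ∘ punchIn y₀))    ≡⟨ cong suc (sum-remove {i = y₀} b) ⟨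
  suc (∑ b)                          ∎
  where open ≡-Reasoning

sum-tabulate : ∀ {n} (a : Fin n → ℕ) → sum (tabulate a) ≡ ∑ a
sum-tabulate {zero}  a = refl
sum-tabulate {suc n} a = cong (a zero +_) (sum-tabulate (a ∘ suc))

tabulate-toℕ : ∀ n (g : ℕ → ℕ) → tabulate {n = n} (g ∘ toℕ) ≡ applyUpTo g n
tabulate-toℕ zero    g = refl
tabulate-toℕ (suc n) g = cong (g 0 ∷_) (tabulate-toℕ n (g ∘ suc))

applyUpTo-+ : ∀ (g : ℕ → ℕ) m n → applyUpTo g (m + n) ≡ applyUpTo g m ++ applyUpTo (g ∘ (m +_)) n
applyUpTo-+ g zero    n = refl
applyUpTo-+ g (suc m) n = cong (g 0 ∷_) (applyUpTo-+ (g ∘ suc) m n)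

applyUpTo-cong : ∀ {g g′ : ℕ → ℕ} → g ≗ g′ → ∀ n → applyUpTo g n ≡ applyUpTo g′ n
applyUpTo-cong g≗g′ zero    = refl
applyUpTo-cong g≗g′ (suc n) = cong₂ _∷_ (g≗g′ 0) (applyUpTo-cong (g≗g′ ∘ suc) n)

toℕ-punchIn-< : ∀ {k} (x : Fin (suc k)) (y : Fin k) → toℕ y < toℕ x → toℕ (punchIn x y) ≡ toℕ y
toℕ-punchIn-< (suc x) zero    _         = refl
toℕ-punchIn-< (suc x) (suc y) (s≤s y<x) = cong suc (toℕ-punchIn-< x y y<x)

toℕ-punchIn-≥ : ∀ {k} (x : Fin (suc k)) (y : Fin k) → toℕ x ≤ toℕ y → toℕ (punchIn x y) ≡ suc (toℕ y)
toℕ-punchIn-≥ zero    y       _         = refl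
toℕ-punchIn-≥ (suc x) (suc y) (s≤s x≤y) = cong suc (toℕ-punchIn-≥ x y x≤y)

toℕ-punchIn : ∀ {k} (x : Fin (suc k)) (y : Fin k) →
              (toℕ y < toℕ x × toℕ (punchIn x y) ≡ toℕ y) ⊎ (toℕ x ≤ toℕ y × toℕ (punchIn x y) ≡ suc (toℕ y))
toℕ-punchIn x y with toℕ y <? toℕ x
... | yes y<x = inj₁ (y<x , toℕ-punchIn-< x y y<x)
... | no  y≮x = inj₂ (≮⇒≥ y≮x , toℕ-punchIn-≥ x y (≮⇒≥ y≮x))

toℕ-punchIn-cong : ∀ {k k′} (x : Fin (suc k)) (x′ : Fin (suc k′)) y y′ →
                   toℕ x ≡ toℕ x′ → toℕ y ≡ toℕ y′ → toℕ (punchIn x y) ≡ toℕ (punchIn x′ y′)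
toℕ-punchIn-cong x x′ y y′ x≡x′ y≡y′ with toℕ-punchIn x y
... | inj₁ (y<x , eq) = trans eq (trans y≡y′ (sym (toℕ-punchIn-< x′ y′ (subst₂ _<_ y≡y′ x≡x′ y<x))))
... | inj₂ (x≤y , eq) =
  trans eq (trans (cong suc y≡y′) (sym (toℕ-punchIn-≥ x′ y′ (subst₂ _≤_ x≡x′ y≡y′ x≤y))))

Fin-empty : ∀ {k} → ¬ Fin k → k ≡ 0
Fin-empty {zero}  _    = refl
Fin-empty {suc k} ¬fin = contradiction zero ¬fin

Fin-singleton : ∀ {k} (x : Fin k) → (∀ y → y ≡ x) → k ≡ 1
Fin-singleton {suc zero}    _ _    = refl
Fin-singleton {suc (suc k)} _ ≡x with trans (≡x zero) (sym (≡x (suc zero)))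
... | ()

Fin-pair : ∀ {n} (c : Fin (suc n)) → c ≢ zero → (∀ y → y ≡ zero ⊎ y ≡ c) → suc n ≡ 2
Fin-pair {zero}        zero c≢0 _ = contradiction refl c≢0
Fin-pair {suc zero}    _    _   _ = refl
Fin-pair {suc (suc n)} c    _   ≡0∨c with ≡0∨c (suc zero) | ≡0∨c (suc (suc zero))
... | inj₁ () | _
... | inj₂ _  | inj₁ ()
... | inj₂ 1≡c | inj₂ 2≡c with trans 1≡c (sym 2≡c)
... | ()

-- Counting the cycles of a permutation of Fin n

IsCycleMin : ∀ {n} → (Fin n → Fin n) → Fin n → Set
IsCycleMin f i = ∀ k → toℕ i ≤ toℕ (iter f k i)

-- A cycle is counted through its least element, as faces are counted by isFaceRep.
isCycleMin : ∀ {n} → (Fin n → Fin n) → Fin n → Bool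
isCycleMin {n} f i = all (λ k → toℕ i ≤ᵇ toℕ (iter f k i)) (upTo n)

𝟙 : Bool → ℕ
𝟙 b = if b then 1 else 0

numCycles : ∀ n → (Fin n → Fin n) → ℕ
numCycles n f = ∑ {n} (λ i → 𝟙 (isCycleMin f i))

𝟙-cong : ∀ {a b} → (T a → T b) → (T b → T a) → 𝟙 a ≡ 𝟙 b
𝟙-cong {false} {false} _ _ = refl
𝟙-cong {false} {true}  _ b⇒a = contradiction (b⇒a _) id
𝟙-cong {true}  {false} a⇒b _ = contradiction (a⇒b _) id
𝟙-cong {true}  {true}  _ _ = refl

𝟙-true : ∀ {a} → T a → 𝟙 a ≡ 1
𝟙-true {true} _ = refl

𝟙-false : ∀ {a} → ¬ T a → 𝟙 a ≡ 0
𝟙-false {false} _ = refl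
𝟙-false {true}  ¬a = contradiction _ ¬a

numCycles-cong : ∀ n {f g : Fin n → Fin n} → f ≗ g → numCycles n f ≡ numCycles n g
numCycles-cong n f≗g = sum-cong-≗ λ i → cong (𝟙 ∘ and)
  (map-cong (λ k → cong (λ y → toℕ i ≤ᵇ toℕ y) (iter-cong f≗g k i)) (upTo n))

numCycles-cast : ∀ {K K′} (eq : K ≡ K′) (f : Fin K → Fin K) →
                 numCycles K f ≡ numCycles K′ (cast eq ∘ f ∘ cast (sym eq))
numCycles-cast {K} refl f = numCycles-cong K λ z → sym (trans (cast-is-id refl _) (cong f (cast-is-id refl z)))

module Orbits {n : ℕ} {f : Fin n → Fin n} (f-inj : Injection f) where

  period : ∀ x → ∃ λ p → 1 ≤ p × p ≤ n × iter f p x ≡ x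
  period x with pigeonhole (n<1+n n) (λ (k : Fin (suc n)) → iter f (toℕ k) x)
  ... | i , j , i<j , fⁱx≡fʲx = toℕ j ∸ toℕ i , m<n⇒0<n∸m i<j
                                 , ≤-trans (m∸n≤m (toℕ j) (toℕ i)) (s≤s⁻¹ (toℕ<n j))
                                 , sym (iter-injective f-inj (toℕ i) fⁱx≡fⁱ⁺ᵈx)
    where
    fⁱx≡fⁱ⁺ᵈx : iter f (toℕ i) x ≡ iter f (toℕ i) (iter f (toℕ j ∸ toℕ i) x)
    fⁱx≡fⁱ⁺ᵈx = trans fⁱx≡fʲx (trans (cong (λ m → iter f m x) (sym (m+[n∸m]≡n (<⇒≤ i<j))))
                                     (iter-+ f (toℕ i) _ x))

  iter-reduce : ∀ k x → ∃ λ r → r < n × iter f k x ≡ iter f r x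
  iter-reduce k x with period x
  ... | p , p≥1 , p≤n , fᵖx≡x = k % p , <-≤-trans (m%n<n k p) p≤n , (begin
      iter f k x                       ≡⟨ cong (λ m → iter f m x) (m≡m%n+[m/n]*n k p) ⟩
      iter f (k % p + k / p * p) x     ≡⟨ iter-+ f (k % p) _ x ⟩
      iter f (k % p) (iter f (k / p * p) x) ≡⟨ cong (iter f (k % p)) (iter-periodic f fᵖx≡x (k / p)) ⟩
      iter f (k % p) x                 ∎)
    where
    open ≡-Reasoning
    instance
      p≢0 : NonZero p
      p≢0 = >-nonZero p≥1

  iter-reverse : ∀ a {z w} → iter f a z ≡ w → ∃ λ b → iter f b w ≡ z
  iter-reverse a {z} refl with period z
  ... | p , p≥1 , _ , fᵖz≡z = a * p ∸ a , (begin
      iter f (a * p ∸ a) (iter f a z) ≡⟨ iter-∸ f z a≤ap ⟨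
      iter f (a * p) z                ≡⟨ iter-periodic f fᵖz≡z a ⟩
      z                               ∎)
    where
    open ≡-Reasoning
    a≤ap : a ≤ a * p
    a≤ap = subst (_≤ a * p) (*-identityʳ a) (*-monoʳ-≤ a p≥1)

  isCycleMin⇒IsCycleMin : ∀ {i} → T (isCycleMin f i) → IsCycleMin f i
  isCycleMin⇒IsCycleMin {i} t k with iter-reduce k i
  ... | r , r<n , fᵏi≡fʳi = subst (λ y → toℕ i ≤ toℕ y) (sym fᵏi≡fʳi)
                              (≤ᵇ⇒≤ _ _ (applyUpTo⁻ id n (all⁺ _ (upTo n) t) r<n))

  IsCycleMin⇒isCycleMin : ∀ {i} → IsCycleMin f i → T (isCycleMin f i)
  IsCycleMin⇒isCycleMin min = all⁻ _ (applyUpTo⁺₂ id n (λ k → ≤⇒≤ᵇ (min k)))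

  ¬isCycleMin⇒descent : ∀ {i} → ¬ T (isCycleMin f i) → ∃ λ k → toℕ (iter f k i) < toℕ i
  ¬isCycleMin⇒descent ¬min with satisfied (¬All⇒Any¬ (λ k → T? _) (upTo n) (¬min ∘ all⁻ _))
  ... | k , ¬i≤fᵏi = k , ≰⇒> (¬i≤fᵏi ∘ ≤⇒≤ᵇ)

  cycleMin-exists : ∀ u → ∃ λ k → IsCycleMin f (iter f k u)
  cycleMin-exists u = descend u (<-wellFounded (toℕ u))
    where
    descend : ∀ u → Acc _<_ (toℕ u) → ∃ λ k → IsCycleMin f (iter f k u)
    descend u (acc rs) with T? (isCycleMin f u)
    ... | yes min = 0 , isCycleMin⇒IsCycleMin min
    ... | no ¬min with ¬isCycleMin⇒descent ¬min
    ... | k , fᵏu<u with descend (iter f k u) (rs fᵏu<u)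
    ... | k′ , min = k′ + k , subst (IsCycleMin f) (sym (iter-+ f k′ k u)) min

  cycleMin-unique : ∀ {a b} → IsCycleMin f a → IsCycleMin f b → ∀ k → iter f k a ≡ b → a ≡ b
  cycleMin-unique {a} {b} min-a min-b k fᵏa≡b with iter-reverse k fᵏa≡b
  ... | k′ , fᵏ′b≡a = toℕ-injective (≤-antisym (subst (λ z → toℕ a ≤ toℕ z) fᵏa≡b (min-a k))
                                                (subst (λ z → toℕ b ≤ toℕ z) fᵏ′b≡a (min-b k′)))

-- First-return maps

Image : {A B : Set} → (B → A) → A → Set
Image H a = ∃ λ b → H b ≡ a

record FirstReturn {A : Set} (f : A → A) (P : A → Set) (z w : A) : Set where
  constructor firstReturn
  field
    time    : ℕ
    time≥1  : 1 ≤ time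
    arrives : iter f time z ≡ w
    avoids  : ∀ i → 1 ≤ i → i < time → ¬ P (iter f i z)

firstReturn-unique : ∀ {A : Set} {f : A → A} {P : A → Set} {z w w′} → P w → P w′ →
                     FirstReturn f P z w → FirstReturn f P z w′ → w ≡ w′
firstReturn-unique pw pw′ (firstReturn t t≥1 arr avoids) (firstReturn t′ t′≥1 arr′ avoids′)
  with <-cmp t t′
... | tri< t<t′ _ _ = contradiction (subst _ (sym arr) pw) (avoids′ t t≥1 t<t′)
... | tri≈ _ refl _ = trans (sym arr) arr′
... | tri> _ _ t>t′ = contradiction (subst _ (sym arr′) pw′) (avoids t′ t′≥1 t>t′)

firstReturn-step : ∀ {A : Set} {f : A → A} {P : A → Set} {z w} → f z ≡ w → FirstReturn f P z w
firstReturn-step fz≡w = firstReturn 1 ≤-refl fz≡w λ k k≥1 k<1 → contradiction (≤-<-trans k≥1 k<1) (<-irrefl refl)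

firstReturn-map : ∀ {A A′ : Set} {f : A → A} {f′ : A′ → A′} {P : A → Set} {P′ : A′ → Set} (e : A → A′) →
                  (∀ k a → iter f′ k (e a) ≡ e (iter f k a)) → (∀ {a} → P′ (e a) → P a) →
                  ∀ {z w} → FirstReturn f P z w → FirstReturn f′ P′ (e z) (e w)
firstReturn-map {P′ = P′} e iter-e reflect (firstReturn t t≥1 arr avoids) =
  firstReturn t t≥1 (trans (iter-e t _) (cong e arr))
              λ k k≥1 k<t p′ → avoids k k≥1 k<t (reflect (subst P′ (iter-e k _) p′))

module FirstReturnMap {A B : Set} {f : A → A} {H : B → A} (H-inj : Injection H) {f′ : B → B}
                      (returns : ∀ y → FirstReturn f (Image H) (H y) (H (f′ y))) where

  Passage : ℕ → B → A → Set
  Passage k y a = ¬ Image H a ⊎ ∃ λ k′ → 1 ≤ k′ × k′ ≤ k × a ≡ H (iter f′ k′ y)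

  return-iterate : ∀ k y → ∃ λ J → 1 ≤ J × iter f J (H y) ≡ H (iter f′ (suc k) y) ×
                     (∀ i → 1 ≤ i → i < J → Passage k y (iter f i (H y)))
  return-iterate zero y = time , time≥1 , arrives , λ i i≥1 i<t → inj₁ (avoids i i≥1 i<t)
    where open FirstReturn (returns y)
  return-iterate (suc k) y with return-iterate k y | returns (iter f′ (suc k) y)
  ... | J , J≥1 , fᴶ≡ , between | firstReturn t _ arr avoids =
    t + J , ≤-trans J≥1 (m≤n+m J t) , trans (iter-+ f t J _) (trans (cong (iter f t) fᴶ≡) arr) , between′
    where
    between′ : ∀ i → 1 ≤ i → i < t + J → Passage (suc k) y (iter f i (H y))
    between′ i i≥1 i<t+J with <-cmp i J
    ... | tri< i<J _ _ with between i i≥1 i<J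
    ...   | inj₁ ∉H = inj₁ ∉H
    ...   | inj₂ (k′ , k′≥1 , k′≤k , eq) = inj₂ (k′ , k′≥1 , m≤n⇒m≤1+n k′≤k , eq)
    between′ i i≥1 i<t+J | tri≈ _ refl _ = inj₂ (suc k , s≤s z≤n , ≤-refl , fᴶ≡)
    between′ i i≥1 i<t+J | tri> _ _ i>J =
      inj₁ (subst (¬_ ∘ Image H) (sym fⁱ≡) (avoids (i ∸ J) (m<n⇒0<n∸m i>J) i∸J<t))
      where
      fⁱ≡ : iter f i (H y) ≡ iter f (i ∸ J) (H (iter f′ (suc k) y))
      fⁱ≡ = trans (iter-∸ f _ (<⇒≤ i>J)) (cong (iter f (i ∸ J)) fᴶ≡)
      i∸J<t : i ∸ J < t
      i∸J<t = subst (i ∸ J <_) (m+n∸n≡m t J) (∸-monoˡ-< i<t+J (<⇒≤ i>J))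

  firstReturn-∘ : ∀ {C : Set} {K : C → B} {y w} → FirstReturn f′ (Image K) y w →
                  FirstReturn f (Image (H ∘ K)) (H y) (H w)
  firstReturn-∘ {K = K} {y} (firstReturn (suc j) _ arr avoids) with return-iterate j y
  ... | J , J≥1 , fᴶ≡ , between = firstReturn J J≥1 (trans fᴶ≡ (cong H arr)) avoids′
    where
    avoids′ : ∀ i → 1 ≤ i → i < J → ¬ Image (H ∘ K) (iter f i (H y))
    avoids′ i i≥1 i<J (c , eq) with between i i≥1 i<J
    ... | inj₁ ∉H = ∉H (K c , eq)
    ... | inj₂ (k′ , k′≥1 , k′≤j , eq′) = avoids k′ k′≥1 (s≤s k′≤j) (c , H-inj (trans eq eq′))

  Visited : ℕ → B → ℕ → Set
  Visited J y k = ∀ i → 1 ≤ i → i < k → ∃ λ i′ → 1 ≤ i′ × i′ < J × H (iter f′ i y) ≡ iter f i′ (H y)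

  returns-to : ∀ J y {w} → 1 ≤ J → iter f J (H y) ≡ H w →
               ∃ λ k → 1 ≤ k × iter f′ k y ≡ w × Visited J y k
  returns-to J = go J (<-wellFounded J)
    where
    go : ∀ J → Acc _<_ J → ∀ y {w} → 1 ≤ J → iter f J (H y) ≡ H w →
         ∃ λ k → 1 ≤ k × iter f′ k y ≡ w × Visited J y k
    go J (acc rs) y {w} J≥1 fᴶ≡ with returns y
    ... | firstReturn t t≥1 arr avoids with <-cmp t J
    ... | tri> _ _ t>J = contradiction (w , sym fᴶ≡) (avoids J J≥1 t>J)
    ... | tri≈ _ refl _ =
      1 , ≤-refl , H-inj (trans (sym arr) fᴶ≡) , λ i i≥1 i<1 → contradiction (≤-<-trans i≥1 i<1) (<-irrefl refl)
    ... | tri< t<J _ _ with go (J ∸ t) (rs (∸-monoʳ-< t≥1 (<⇒≤ t<J))) (f′ y) (m<n⇒0<n∸m t<J) rest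
      where
      rest : iter f (J ∸ t) (H (f′ y)) ≡ H w
      rest = trans (cong (iter f (J ∸ t)) (sym arr)) (trans (sym (iter-∸ f _ (<⇒≤ t<J))) fᴶ≡)
    ... | k , k≥1 , f′ᵏ≡ , visited = suc k , s≤s z≤n , trans (iter-sucʳ f′ k y) f′ᵏ≡ , visited′
      where
      visited′ : Visited J y (suc k)
      visited′ (suc zero)    _ _ = t , t≥1 , t<J , sym arr
      visited′ (suc (suc i)) _ (s≤s i<k) with visited (suc i) (s≤s z≤n) i<k
      ... | i′ , i′≥1 , i′<J∸t , eq = i′ + t , ≤-trans i′≥1 (m≤m+n i′ t)
        , subst (i′ + t <_) (m∸n+n≡m (<⇒≤ t<J)) (+-monoˡ-< t i′<J∸t)
        , trans (cong H (iter-sucʳ f′ (suc i) y))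
                (trans eq (trans (cong (iter f i′) (sym arr)) (sym (iter-+ f i′ t (H y)))))

  fixed-orbit : ∀ {y} → f′ y ≡ y → ∀ j {w} → iter f j (H y) ≡ H w → w ≡ y
  fixed-orbit         f′y≡y zero    eq = sym (H-inj eq)
  fixed-orbit {y} f′y≡y (suc j) eq with returns-to (suc j) y (s≤s z≤n) eq
  ... | k , _ , f′ᵏy≡w , _ = trans (sym f′ᵏy≡w) (iter-fixed k)
    where
    iter-fixed : ∀ k → iter f′ k y ≡ y
    iter-fixed zero    = refl
    iter-fixed (suc k) = trans (cong f′ (iter-fixed k)) f′y≡y

-- Deleting points from a permutation

module Skip {n : ℕ} {f : Fin (suc n) → Fin (suc n)} (f-inj : Injection f)
            (x : Fin (suc n)) (fx≢x : f x ≢ x) where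

  private
    h : Fin n → Fin (suc n)
    h = punchIn x

  jump : Fin (suc n) → Fin (suc n)
  jump z with f z ≟ x
  ... | yes _ = f (f z)
  ... | no  _ = f z

  jump-cases : ∀ z → (f z ≡ x × jump z ≡ f (f z)) ⊎ (f z ≢ x × jump z ≡ f z)
  jump-cases z with f z ≟ x
  ... | yes fz≡x = inj₁ (fz≡x , refl)
  ... | no  fz≢x = inj₂ (fz≢x , refl)

  jump≢x : ∀ z → jump z ≢ x
  jump≢x z with jump-cases z
  ... | inj₁ (fz≡x , eq) = λ j≡x → fx≢x (trans (cong f (sym fz≡x)) (trans (sym eq) j≡x))
  ... | inj₂ (fz≢x , eq) = λ j≡x → fz≢x (trans (sym eq) j≡x)

  jump-injective : ∀ {a b} → a ≢ x → b ≢ x → jump a ≡ jump b → a ≡ b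
  jump-injective {a} {b} a≢x b≢x eq with jump-cases a | jump-cases b
  ... | inj₁ (fa≡x , ea) | inj₁ (fb≡x , eb) = f-inj (trans fa≡x (sym fb≡x))
  ... | inj₁ (fa≡x , ea) | inj₂ (_ , eb) =
    contradiction (sym (trans (sym fa≡x) (f-inj (trans (sym ea) (trans eq eb))))) b≢x
  ... | inj₂ (_ , ea) | inj₁ (fb≡x , eb) =
    contradiction (sym (trans (sym fb≡x) (f-inj (trans (sym eb) (trans (sym eq) ea))))) a≢x
  ... | inj₂ (_ , ea) | inj₂ (_ , eb) = f-inj (trans (sym ea) (trans eq eb))

  f′ : Fin n → Fin n
  f′ y = punchOut (jump≢x (h y) ∘ sym)

  h-f′ : ∀ y → h (f′ y) ≡ jump (h y)
  h-f′ y = punchIn-punchOut _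

  f′-injective : Injection f′
  f′-injective {a} {b} eq = punchIn-injective x a b
    (jump-injective (punchInᵢ≢i x a) (punchInᵢ≢i x b) (trans (sym (h-f′ a)) (trans (cong h eq) (h-f′ b))))

  returns : ∀ y → FirstReturn f (Image h) (h y) (h (f′ y))
  returns y with jump-cases (h y)
  ... | inj₁ (fhy≡x , eq) = firstReturn 2 (s≤s z≤n) (sym (trans (h-f′ y) eq)) avoids
    where
    avoids : ∀ i → 1 ≤ i → i < 2 → ¬ Image h (iter f i (h y))
    avoids 1 _ _ (c , hc≡x) = punchInᵢ≢i x c (trans hc≡x fhy≡x)
    avoids (suc (suc _)) _ (s≤s (s≤s ()))
  ... | inj₂ (_ , eq) = firstReturn-step (sym (trans (h-f′ y) eq))

  open FirstReturnMap (punchIn-injective x _ _) returns public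

  f′-orbit : ∀ k y → ∃ λ J → iter f J (h y) ≡ h (iter f′ k y)
  f′-orbit zero    y = 0 , refl
  f′-orbit (suc k) y = let J , _ , fᴶ≡ , _ = return-iterate k y in J , fᴶ≡

  f-orbit : ∀ j y → iter f j (h y) ≡ x ⊎ ∃ λ k → iter f j (h y) ≡ h (iter f′ k y)
  f-orbit zero    y = inj₂ (0 , refl)
  f-orbit (suc j) y with iter f (suc j) (h y) ≟ x
  ... | yes fʲ≡x = inj₁ fʲ≡x
  ... | no  fʲ≢x with returns-to (suc j) y (s≤s z≤n) (sym (punchIn-punchOut (fʲ≢x ∘ sym)))
  ... | k , _ , f′ᵏ≡ , _ = inj₂ (k , trans (sym (punchIn-punchOut _)) (cong h (sym f′ᵏ≡)))

  private
    module F  = Orbits f-inj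
    module F′ = Orbits f′-injective

    c : Fin (suc n) → ℕ
    c = 𝟙 ∘ isCycleMin f

    c′ : Fin n → ℕ
    c′ = 𝟙 ∘ isCycleMin f′

  lift-min : ∀ {y} → IsCycleMin f (h y) → IsCycleMin f′ y
  lift-min {y} min k = let J , fᴶ≡ = f′-orbit k y in
    punchIn-cancel-≤ x y (iter f′ k y) (subst (λ z → toℕ (h y) ≤ toℕ z) fᴶ≡ (min J))

  lifts : ∀ y → T (isCycleMin f (h y)) → T (isCycleMin f′ y)
  lifts y = F′.IsCycleMin⇒isCycleMin ∘ lift-min ∘ F.isCycleMin⇒IsCycleMin

  below-min : ∀ {y} → IsCycleMin f′ y → ∀ j → iter f j (h y) ≢ x → toℕ (h y) ≤ toℕ (iter f j (h y))
  below-min {y} min j fʲ≢x with f-orbit j y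
  ... | inj₁ fʲ≡x      = contradiction fʲ≡x fʲ≢x
  ... | inj₂ (k , fʲ≡) = subst (λ z → toℕ (h y) ≤ toℕ z) (sym fʲ≡) (punchIn-mono-≤ x y _ (min k))

  x-undercuts : ∀ {y} → IsCycleMin f′ y → ¬ T (isCycleMin f (h y)) →
                ∃ λ j → iter f j (h y) ≡ x × toℕ x < toℕ (h y)
  x-undercuts {y} min ¬min with F.¬isCycleMin⇒descent ¬min
  ... | j , fʲ<hy with iter f j (h y) ≟ x
  ... | yes fʲ≡x = j , fʲ≡x , subst (λ z → toℕ z < toℕ (h y)) fʲ≡x fʲ<hy
  ... | no  fʲ≢x = contradiction (below-min min j fʲ≢x) (<⇒≱ fʲ<hy)

  x-cycleMin : ∀ {y} → IsCycleMin f′ y → ¬ T (isCycleMin f (h y)) → IsCycleMin f x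
  x-cycleMin {y} min ¬min k with x-undercuts min ¬min
  ... | j , fʲ≡x , x<hy with iter f k x ≟ x
  ... | yes fᵏx≡x = subst (λ z → toℕ x ≤ toℕ z) (sym fᵏx≡x) ≤-refl
  ... | no  fᵏx≢x = ≤-trans (<⇒≤ x<hy)
          (subst (λ z → toℕ (h y) ≤ toℕ z) fᵏ⁺ʲ≡ (below-min min (k + j) (fᵏx≢x ∘ trans (sym fᵏ⁺ʲ≡))))
    where
    fᵏ⁺ʲ≡ : iter f (k + j) (h y) ≡ iter f k x
    fᵏ⁺ʲ≡ = trans (iter-+ f k j (h y)) (cong (iter f k) fʲ≡x)

  module _ (min-x : IsCycleMin f x) where

    private
      u : Fin n
      u = punchOut (fx≢x ∘ sym)

    y₀ : Fin n
    y₀ = iter f′ (proj₁ (F′.cycleMin-exists u)) u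

    min-y₀ : IsCycleMin f′ y₀
    min-y₀ = proj₂ (F′.cycleMin-exists u)

    x↝y₀ : ∃ λ J → iter f J x ≡ h y₀
    x↝y₀ = let J , fᴶ≡ = f′-orbit (proj₁ (F′.cycleMin-exists u)) u in
      suc J , trans (iter-sucʳ f J x) (trans (cong (iter f J) (sym (punchIn-punchOut _))) fᴶ≡)

    ¬min-hy₀ : ¬ IsCycleMin f (h y₀)
    ¬min-hy₀ min = let J , fᴶ≡ = x↝y₀ in punchInᵢ≢i x y₀ (sym (F.cycleMin-unique min-x min J fᴶ≡))

    only-y₀-drops : ∀ {y} → IsCycleMin f′ y → ¬ T (isCycleMin f (h y)) → y ≡ y₀
    only-y₀-drops {y} min ¬min with x-undercuts min ¬min | x↝y₀
    ... | j , fʲ≡x , _ | J , fᴶ≡ with f-orbit (J + j) y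
    ...   | inj₁ ≡x       = contradiction (trans (sym hy↝hy₀) ≡x) (punchInᵢ≢i x y₀)
      where hy↝hy₀ = trans (iter-+ f J j (h y)) (trans (cong (iter f J) fʲ≡x) fᴶ≡)
    ...   | inj₂ (k , ≡h) = F′.cycleMin-unique min min-y₀ k (punchIn-injective x _ _ (trans (sym ≡h) hy↝hy₀))
      where hy↝hy₀ = trans (iter-+ f J j (h y)) (trans (cong (iter f J) fʲ≡x) fᴶ≡)

  -- The cycles of f′ are those of f with x deleted; only when x is the least element of its cycle
  -- does that cycle get a new least element, namely y₀.
  numCycles-f′ : numCycles n f′ ≡ numCycles (suc n) f
  numCycles-f′ with T? (isCycleMin f x)
  ... | no ¬min-x = begin
    ∑ c′                ≡⟨ sum-cong-≗ (λ y → 𝟙-cong (stays y) (lifts y)) ⟩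
    ∑ (c ∘ h)           ≡⟨ cong (_+ ∑ (c ∘ h)) (𝟙-false ¬min-x) ⟨
    c x + ∑ (c ∘ h)     ≡⟨ sum-remove {i = x} c ⟨
    numCycles (suc n) f ∎
    where
    open ≡-Reasoning
    stays : ∀ y → T (isCycleMin f′ y) → T (isCycleMin f (h y))
    stays y t with T? (isCycleMin f (h y))
    ... | yes t′ = t′
    ... | no ¬t′ = contradiction (F.IsCycleMin⇒isCycleMin (x-cycleMin (F′.isCycleMin⇒IsCycleMin t) ¬t′)) ¬min-x
  ... | yes min-x = begin
    ∑ c′                ≡⟨ sum-bump c′ (c ∘ h) (y₀ min) at-y₀ (λ y y≢y₀ → 𝟙-cong (stays y≢y₀) (lifts y)) ⟩
    suc (∑ (c ∘ h))     ≡⟨ cong (_+ ∑ (c ∘ h)) (𝟙-true min-x) ⟨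
    c x + ∑ (c ∘ h)     ≡⟨ sum-remove {i = x} c ⟨
    numCycles (suc n) f ∎
    where
    open ≡-Reasoning
    min = F.isCycleMin⇒IsCycleMin min-x
    at-y₀ : c′ (y₀ min) ≡ suc (c (h (y₀ min)))
    at-y₀ = trans (𝟙-true (F′.IsCycleMin⇒isCycleMin (min-y₀ min)))
                  (cong suc (sym (𝟙-false (¬min-hy₀ min ∘ F.isCycleMin⇒IsCycleMin))))
    stays : ∀ {y} → y ≢ y₀ min → T (isCycleMin f′ y) → T (isCycleMin f (h y))
    stays {y} y≢y₀ t with T? (isCycleMin f (h y))
    ... | yes t′ = t′
    ... | no ¬t′ = contradiction (only-y₀-drops min (F′.isCycleMin⇒IsCycleMin t) ¬t′) y≢y₀

record Induced {K : ℕ} (f₀ : Fin K → Fin K) (M : ℕ) : Set where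
  field
    f       : Fin M → Fin M
    f-inj   : Injection f
    H       : Fin M → Fin K
    H-inj   : Injection H
    returns : ∀ y → FirstReturn f₀ (Image H) (H y) (H (f y))
    count   : numCycles M f ≡ numCycles K f₀

induced-self : ∀ {K} {f₀ : Fin K → Fin K} → Injection f₀ → Induced f₀ K
induced-self {f₀ = f₀} f₀-inj = record
  { f = f₀ ; f-inj = f₀-inj ; H = id ; H-inj = id ; returns = λ _ → firstReturn-step refl ; count = refl }

induced-delete : ∀ {K M} {f₀ : Fin K → Fin K} (s : Induced f₀ (suc M)) (x : Fin (suc M)) →
                 (∀ z → ∃ λ j → Image (Induced.H s ∘ punchIn x) (iter f₀ j z)) → Induced f₀ M
induced-delete s x meets = record
  { f = S.f′ ; f-inj = S.f′-injective ; H = H ∘ punchIn x ; H-inj = punchIn-injective x _ _ ∘ H-inj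
  ; returns = R.firstReturn-∘ ∘ S.returns ; count = trans S.numCycles-f′ count }
  where
  open Induced s
  module R = FirstReturnMap H-inj returns
  fx≢x : f x ≢ x
  fx≢x fx≡x = let j , w , eq = meets (H x) in punchInᵢ≢i x w (R.fixed-orbit fx≡x j (sym eq))
  module S = Skip f-inj x fx≢x

rot³ : ∀ k → rot (rot (rot k)) ≡ k
rot³ zero             = refl
rot³ (suc zero)       = refl
rot³ (suc (suc zero)) = refl

rot≢id : ∀ k → rot k ≢ k
rot≢id zero             ()
rot≢id (suc zero)       ()
rot≢id (suc (suc zero)) ()

rot²≢id : ∀ k → rot (rot k) ≢ k
rot²≢id zero             ()
rot²≢id (suc zero)       ()
rot²≢id (suc (suc zero)) ()

rot-injective : Injection rot
rot-injective {zero}             {zero}             _ = refl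
rot-injective {suc zero}         {suc zero}         _ = refl
rot-injective {suc (suc zero)}   {suc (suc zero)}   _ = refl
rot-injective {zero}             {suc zero}         ()
rot-injective {zero}             {suc (suc zero)}   ()
rot-injective {suc zero}         {zero}             ()
rot-injective {suc zero}         {suc (suc zero)}   ()
rot-injective {suc (suc zero)}   {zero}             ()
rot-injective {suc (suc zero)}   {suc zero}         ()

rot-orbit : ∀ i k → k ≡ i ⊎ k ≡ rot i ⊎ k ≡ rot (rot i)
rot-orbit zero             zero             = inj₁ refl
rot-orbit zero             (suc zero)       = inj₂ (inj₁ refl)
rot-orbit zero             (suc (suc zero)) = inj₂ (inj₂ refl)
rot-orbit (suc zero)       zero             = inj₂ (inj₂ refl)
rot-orbit (suc zero)       (suc zero)       = inj₁ refl
rot-orbit (suc zero)       (suc (suc zero)) = inj₂ (inj₁ refl)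
rot-orbit (suc (suc zero)) zero             = inj₂ (inj₁ refl)
rot-orbit (suc (suc zero)) (suc zero)       = inj₂ (inj₂ refl)
rot-orbit (suc (suc zero)) (suc (suc zero)) = inj₁ refl

vertexDart-injective : ∀ {nB nI} {w w′ : Fin nI} {k k′ : Fin 3} →
                       inj₂ {A = Fin nB} (w , k) ≡ inj₂ (w′ , k′) → w ≡ w′ × k ≡ k′
vertexDart-injective = Product.,-injective ∘ Sum.inj₂-injective

σ-injective : ∀ {nB nI} → Injection (σ {nB} {nI})
σ-injective {x = inj₁ _}       {inj₁ _}        eq = eq
σ-injective {x = inj₂ (w , k)} {inj₂ (w′ , k′)} eq with vertexDart-injective eq
... | refl , rk≡rk′ = cong (λ j → inj₂ (w , j)) (rot-injective rk≡rk′)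

_≟ᴰ_ : ∀ {nB nI} → DecidableEquality (Dart nB nI)
_≟ᴰ_ = Sum.≡-dec _≟_ (Product.≡-dec _≟_ _≟_)

CycSucc-punchIn : ∀ n (b : Fin (suc n)) (c c′ : Fin n) → CycSucc n c c′ →
                  CycSucc (suc n) (punchIn b c) (punchIn b c′) ⊎
                  (CycSucc (suc n) (punchIn b c) b × CycSucc (suc n) b (punchIn b c′))
CycSucc-punchIn n b c c′ (inj₁ 1+c≡c′) with toℕ-punchIn b c | toℕ-punchIn b c′
... | inj₁ (_ , eq) | inj₁ (_ , eq′) = inj₁ (inj₁ (trans (cong suc eq) (trans 1+c≡c′ (sym eq′))))
... | inj₁ (c<b , eq) | inj₂ (b≤c′ , eq′) =
  inj₂ (inj₁ (trans (cong suc eq) (sym b≡1+c)) , inj₁ (trans (cong suc b≡1+c) (trans (cong suc 1+c≡c′) (sym eq′))))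
  where
  b≡1+c : toℕ b ≡ suc (toℕ c)
  b≡1+c = ≤-antisym (subst (toℕ b ≤_) (sym 1+c≡c′) b≤c′) c<b
... | inj₂ (b≤c , _) | inj₁ (c′<b , _) =
  contradiction (<-≤-trans (subst (_< toℕ b) (sym 1+c≡c′) c′<b) (≤-trans b≤c (n≤1+n _))) (<-irrefl refl)
... | inj₂ (_ , eq) | inj₂ (_ , eq′) = inj₁ (inj₁ (trans (cong suc eq) (trans (cong suc 1+c≡c′) (sym eq′))))
CycSucc-punchIn n b c c′ (inj₂ (1+c≡n , c′≡0)) with toℕ-punchIn b c | toℕ-punchIn b c′
... | inj₁ (c<b , eq) | inj₁ (_ , eq′) =
  inj₂ (inj₁ (trans (cong suc eq) (trans 1+c≡n (sym b≡n))) , inj₂ (cong suc b≡n , trans eq′ c′≡0))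
  where
  b≡n : toℕ b ≡ n
  b≡n = ≤-antisym (s≤s⁻¹ (toℕ<n b)) (subst (_≤ toℕ b) 1+c≡n c<b)
... | inj₁ (c<b , _) | inj₂ (b≤c′ , _) =
  contradiction (<-≤-trans (≤-trans (s≤s z≤n) c<b) (subst (toℕ b ≤_) c′≡0 b≤c′)) (<-irrefl refl)
... | inj₂ (_ , eq) | inj₁ (_ , eq′) = inj₁ (inj₂ (cong suc (trans eq 1+c≡n) , trans eq′ c′≡0))
... | inj₂ (_ , eq) | inj₂ (b≤c′ , eq′) =
  inj₂ (inj₂ (cong suc (trans eq 1+c≡n) , b≡0) , inj₁ (trans (cong suc b≡0) (trans (cong suc (sym c′≡0)) (sym eq′))))
  where
  b≡0 : toℕ b ≡ 0
  b≡0 = ≤-antisym (subst (toℕ b ≤_) c′≡0 b≤c′) z≤n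

slotRank : ∀ {m} → Fin m × Fin 3 → ℕ
slotRank (v , i) = 3 * toℕ v + toℕ i

map-slotRank : ∀ {M} m c (G : Fin m → Fin M) → (∀ v → toℕ (G v) ≡ c + toℕ v) →
               map slotRank (cartesianProduct (tabulate G) (allFin 3)) ≡ applyUpTo (3 * c +_) (3 * m)
map-slotRank zero    c G toℕ-G = refl
map-slotRank (suc m) c G toℕ-G = begin
  map slotRank (map (G zero ,_) (allFin 3) ++ cartesianProduct (tabulate (G ∘ suc)) (allFin 3))
    ≡⟨ map-++ slotRank (map (G zero ,_) (allFin 3)) _ ⟩
  applyUpTo (λ k → 3 * toℕ (G zero) + k) 3 ++ map slotRank (cartesianProduct (tabulate (G ∘ suc)) (allFin 3))
    ≡⟨ cong₂ _++_ (applyUpTo-cong (λ k → cong (λ t → 3 * t + k) (trans (toℕ-G zero) (+-identityʳ c))) 3)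
                  (map-slotRank m (suc c) (G ∘ suc) (λ v → trans (toℕ-G (suc v)) (+-suc c (toℕ v)))) ⟩
  applyUpTo (3 * c +_) 3 ++ applyUpTo (3 * suc c +_) (3 * m)
    ≡⟨ cong (applyUpTo (3 * c +_) 3 ++_) (applyUpTo-cong (λ k → shift k) (3 * m)) ⟩
  applyUpTo (3 * c +_) 3 ++ applyUpTo ((3 * c +_) ∘ (3 +_)) (3 * m)
    ≡⟨ applyUpTo-+ (3 * c +_) 3 (3 * m) ⟨
  applyUpTo (3 * c +_) (3 + 3 * m)
    ≡⟨ cong (applyUpTo (3 * c +_)) (*-suc 3 m) ⟨
  applyUpTo (3 * c +_) (3 * suc m)                                       ∎
  where
  open ≡-Reasoning
  shift : ∀ k → 3 * suc c + k ≡ 3 * c + (3 + k)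
  shift k = trans (cong (_+ k) (trans (*-suc 3 c) (+-comm 3 (3 * c)))) (+-assoc (3 * c) 3 k)

dartRank : ∀ {nB nI} → Dart nB nI → ℕ
dartRank (inj₁ b)               = toℕ b
dartRank {nB} (inj₂ (v , i)) = nB + slotRank (v , i)

dartIndex : ∀ {nB nI} → Dart nB nI → Fin (nB + 3 * nI)
dartIndex {nB} {nI} (inj₁ b)      = b ↑ˡ (3 * nI)
dartIndex {nB} {nI} (inj₂ (v , i)) = nB ↑ʳ cast (*-comm nI 3) (combine v i)

indexDart : ∀ {nB nI} → Fin (nB + 3 * nI) → Dart nB nI
indexDart {nB} {nI} k with splitAt nB k
... | inj₁ b = inj₁ b
... | inj₂ j = inj₂ (remQuot 3 (cast (*-comm 3 nI) j))

toℕ-dartIndex : ∀ {nB nI} (d : Dart nB nI) → toℕ (dartIndex d) ≡ dartRank d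
toℕ-dartIndex {nB} {nI} (inj₁ b)      = toℕ-↑ˡ b (3 * nI)
toℕ-dartIndex {nB} {nI} (inj₂ (v , i)) =
  trans (toℕ-↑ʳ nB _) (cong (nB +_) (trans (toℕ-cast _ (combine v i)) (toℕ-combine v i)))

indexDart-dartIndex : ∀ {nB nI} (d : Dart nB nI) → indexDart (dartIndex d) ≡ d
indexDart-dartIndex {nB} {nI} (inj₁ b) rewrite splitAt-↑ˡ nB b (3 * nI) = refl
indexDart-dartIndex {nB} {nI} (inj₂ (v , i))
  rewrite splitAt-↑ʳ nB (3 * nI) (cast (*-comm nI 3) (combine v i))
        | cast-involutive (*-comm 3 nI) (*-comm nI 3) (combine v i)
        | remQuot-combine {nI} {3} v i = refl

dartIndex-indexDart : ∀ {nB nI} (k : Fin (nB + 3 * nI)) → dartIndex {nB} {nI} (indexDart k) ≡ k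
dartIndex-indexDart {nB} {nI} k with splitAt nB k in eq
... | inj₁ b = trans (cong (join nB (3 * nI)) (sym eq)) (join-splitAt nB (3 * nI) k)
... | inj₂ j = trans (cong (nB ↑ʳ_) (trans (cong (cast (*-comm nI 3)) (combine-remQuot {nI} 3 (cast (*-comm 3 nI) j)))
                                          (cast-involutive (*-comm nI 3) (*-comm 3 nI) j)))
                     (trans (cong (join nB (3 * nI)) (sym eq)) (join-splitAt nB (3 * nI) k))

dartIndex-injective : ∀ {nB nI} → Injection (dartIndex {nB} {nI})
dartIndex-injective {_} {_} {d} {d′} eq = trans (sym (indexDart-dartIndex d)) (trans (cong indexDart eq) (indexDart-dartIndex d′))

module _ {nB nI : ℕ} (α : Dart nB nI → Dart nB nI) where

  rank≡dartRank : ∀ d → rank α d ≡ dartRank d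
  rank≡dartRank (inj₁ _) = refl
  rank≡dartRank (inj₂ _) = refl

  map-dartRank : map dartRank (allDarts α) ≡ upTo (nB + 3 * nI)
  map-dartRank = begin
    map dartRank (map inj₁ (allFin nB) ++ map inj₂ (cartesianProduct (allFin nI) (allFin 3)))
      ≡⟨ map-++ dartRank (map inj₁ (allFin nB)) _ ⟩
    map dartRank (map inj₁ (allFin nB)) ++ map dartRank (map inj₂ (cartesianProduct (allFin nI) (allFin 3)))
      ≡⟨ cong₂ _++_ (trans (sym (map-∘ (allFin nB))) (trans (map-tabulate id toℕ) (tabulate-toℕ nB id)))
                    (trans (sym (map-∘ (cartesianProduct (allFin nI) (allFin 3))))
                    (trans (map-∘ (cartesianProduct (allFin nI) (allFin 3)))
                    (trans (cong (map (nB +_)) (map-slotRank nI 0 id (λ _ → refl)))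
                           (map-applyUpTo (3 * 0 +_) (nB +_) (3 * nI))))) ⟩
    applyUpTo id nB ++ applyUpTo (nB +_) (3 * nI)
      ≡⟨ applyUpTo-+ id nB (3 * nI) ⟨
    upTo (nB + 3 * nI)                                  ∎
    where open ≡-Reasoning

  map-dartIndex : map dartIndex (allDarts α) ≡ allFin (nB + 3 * nI)
  map-dartIndex = map-injective toℕ-injective (begin
    map toℕ (map dartIndex (allDarts α))   ≡⟨ map-∘ (allDarts α) ⟨
    map (toℕ ∘ dartIndex) (allDarts α)     ≡⟨ map-cong toℕ-dartIndex (allDarts α) ⟩
    map dartRank (allDarts α)              ≡⟨ map-dartRank ⟩
    upTo (nB + 3 * nI)                     ≡⟨ trans (map-tabulate id toℕ) (tabulate-toℕ _ id) ⟨
    map toℕ (allFin (nB + 3 * nI))         ∎)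
    where open ≡-Reasoning

  faceMap : Fin (nB + 3 * nI) → Fin (nB + 3 * nI)
  faceMap = dartIndex ∘ φ α ∘ indexDart

  iter-faceMap : ∀ k d → iter faceMap k (dartIndex d) ≡ dartIndex (iter (φ α) k d)
  iter-faceMap zero    d = refl
  iter-faceMap (suc k) d = trans (cong faceMap (iter-faceMap k d)) (cong (dartIndex ∘ φ α) (indexDart-dartIndex _))

  isFaceRep≡isCycleMin : ∀ d → isFaceRep α d ≡ isCycleMin faceMap (dartIndex d)
  isFaceRep≡isCycleMin d = cong and (map-cong (λ k → cong₂ _≤ᵇ_ (rank≡toℕ d)
    (trans (rank≡toℕ (iter (φ α) k d)) (cong toℕ (sym (iter-faceMap k d))))) (upTo (nB + 3 * nI)))
    where
    rank≡toℕ : ∀ d → rank α d ≡ toℕ (dartIndex d)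
    rank≡toℕ d = trans (rank≡dartRank d) (sym (toℕ-dartIndex d))

  numFaces≡numCycles : numFaces α ≡ numCycles (nB + 3 * nI) faceMap
  numFaces≡numCycles = begin
    sum (map (λ d → 𝟙 (isFaceRep α d)) (allDarts α))
      ≡⟨ cong sum (map-cong (cong 𝟙 ∘ isFaceRep≡isCycleMin) (allDarts α)) ⟩
    sum (map ((λ k → 𝟙 (isCycleMin faceMap k)) ∘ dartIndex) (allDarts α))
      ≡⟨ cong sum (trans (map-∘ (allDarts α)) (cong (map _) map-dartIndex)) ⟩
    sum (map (λ k → 𝟙 (isCycleMin faceMap k)) (allFin (nB + 3 * nI)))
      ≡⟨ trans (cong sum (map-tabulate id cyc)) (sum-tabulate cyc) ⟩
    numCycles (nB + 3 * nI) faceMap   ∎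
    where
    open ≡-Reasoning
    cyc : Fin (nB + 3 * nI) → ℕ
    cyc k = 𝟙 (isCycleMin faceMap k)

-- Removing one tail

plabic : ∀ {nB nI} → (Fin nI → Colour) → (α : Dart nB nI → Dart nB nI) → (∀ d → α (α d) ≡ d) →
         (∀ d → α d ≢ d) → (∀ d e → Reach α d e) → Planar α → BoundaryOrder α → PlabicGraph
plabic {nB} {nI} col α α-invol α-nofix connected planar order = record
  { nB = nB ; nI = nI ; col = col ; α = α ; α-invol = α-invol ; α-nofix = α-nofix
  ; connected = connected ; planar = planar ; boundaryOrder = order }

euler-tailRemoval : ∀ n m F → 2 * (suc n + suc m) + 2 * F ≡ 4 + (suc n + 3 * suc m) →
                    2 * (n + m) + 2 * F ≡ 4 + (n + 3 * m)
euler-tailRemoval n m F eq = +-cancelˡ-≡ 4 _ _ (trans (sym (before n m F)) (trans eq (after n m)))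
  where
  before : ∀ n m F → 2 * (suc n + suc m) + 2 * F ≡ 4 + (2 * (n + m) + 2 * F)
  before = solve-∀
  after : ∀ n m → 4 + (suc n + 3 * suc m) ≡ 4 + (4 + (n + 3 * m))
  after = solve-∀

module TailRemoval {n m : ℕ} {α : Dart (suc n) (suc m) → Dart (suc n) (suc m)}
  (α-invol : ∀ d → α (α d) ≡ d) (α-nofix : ∀ d → α d ≢ d)
  {b : Fin (suc n)} {v : Fin (suc m)} {i : Fin 3} (tail : α (inj₁ b) ≡ inj₂ (v , i))
  (noLoop : α (inj₂ (v , rot i)) ≢ inj₂ (v , rot (rot i))) where

  private
    D  = Dart (suc n) (suc m)
    D′ = Dart n m

  bd vd v₁ v₂ a₁ a₂ : D
  bd = inj₁ b
  vd = inj₂ (v , i)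
  v₁ = inj₂ (v , rot i)
  v₂ = inj₂ (v , rot (rot i))
  a₁ = α v₁
  a₂ = α v₂

  α-swap : ∀ {x y} → α x ≡ y → x ≡ α y
  α-swap {x} αx≡y = trans (sym (α-invol x)) (cong α αx≡y)

  α-vd : α vd ≡ bd
  α-vd = sym (α-swap tail)

  v₁≢v₂ : v₁ ≢ v₂
  v₁≢v₂ eq = rot≢id (rot i) (sym (proj₂ (vertexDart-injective eq)))

  Survives : D → Set
  Survives (inj₁ c)       = c ≢ b
  Survives (inj₂ (w , _)) = w ≢ v

  survives? : Decidable Survives
  survives? (inj₁ c) with c ≟ b
  ... | yes c≡b = no λ c≢b → c≢b c≡b
  ... | no  c≢b = yes c≢b
  survives? (inj₂ (w , _)) with w ≟ v
  ... | yes w≡v = no λ w≢v → w≢v w≡v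
  ... | no  w≢v = yes w≢v

  removed : ∀ y → ¬ Survives y → y ≡ bd ⊎ y ≡ vd ⊎ y ≡ v₁ ⊎ y ≡ v₂
  removed (inj₁ c) ¬s with c ≟ b
  ... | yes refl = inj₁ refl
  ... | no  c≢b  = contradiction c≢b ¬s
  removed (inj₂ (w , k)) ¬s with w ≟ v
  ... | no  w≢v  = contradiction w≢v ¬s
  ... | yes refl with rot-orbit i k
  ... | inj₁ refl        = inj₂ (inj₁ refl)
  ... | inj₂ (inj₁ refl) = inj₂ (inj₂ (inj₁ refl))
  ... | inj₂ (inj₂ refl) = inj₂ (inj₂ (inj₂ refl))

  survives-other : ∀ {y} → y ≢ bd → y ≢ vd → y ≢ v₁ → y ≢ v₂ → Survives y
  survives-other {y} ≢bd ≢vd ≢v₁ ≢v₂ with survives? y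
  ... | yes s  = s
  ... | no  ¬s with removed y ¬s
  ... | inj₁ ≡bd                = contradiction ≡bd ≢bd
  ... | inj₂ (inj₁ ≡vd)         = contradiction ≡vd ≢vd
  ... | inj₂ (inj₂ (inj₁ ≡v₁))  = contradiction ≡v₁ ≢v₁
  ... | inj₂ (inj₂ (inj₂ ≡v₂))  = contradiction ≡v₂ ≢v₂

  ¬survives-bd : ¬ Survives bd
  ¬survives-bd b≢b = b≢b refl

  ¬survives-v : ∀ k → ¬ Survives (inj₂ (v , k))
  ¬survives-v k v≢v = v≢v refl

  survives-σ : ∀ {y} → Survives y → Survives (σ y)
  survives-σ {inj₁ _} s = s
  survives-σ {inj₂ _} s = s

  survives-σ⁻ : ∀ {y} → Survives (σ y) → Survives y
  survives-σ⁻ {inj₁ _} s = s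
  survives-σ⁻ {inj₂ _} s = s

  survives-a₁ : Survives a₁
  survives-a₁ = survives-other
    (λ a₁≡bd → rot≢id i (proj₂ (vertexDart-injective (trans (α-swap a₁≡bd) tail))))
    (λ a₁≡vd → contradiction (trans (α-swap a₁≡vd) α-vd) λ ())
    (α-nofix v₁)
    noLoop

  survives-a₂ : Survives a₂
  survives-a₂ = survives-other
    (λ a₂≡bd → rot²≢id i (proj₂ (vertexDart-injective (trans (α-swap a₂≡bd) tail))))
    (λ a₂≡vd → contradiction (trans (α-swap a₂≡vd) α-vd) λ ())
    (λ a₂≡v₁ → noLoop (sym (α-swap a₂≡v₁)))
    (α-nofix v₂)

  α-survivor≢bd : ∀ {y} → Survives y → α y ≢ bd
  α-survivor≢bd s αy≡bd = subst Survives (trans (α-swap αy≡bd) tail) s refl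

  α-survivor≢vd : ∀ {y} → Survives y → α y ≢ vd
  α-survivor≢vd s αy≡vd = subst Survives (trans (α-swap αy≡vd) α-vd) s refl

  embed : D′ → D
  embed (inj₁ c)       = inj₁ (punchIn b c)
  embed (inj₂ (w , k)) = inj₂ (punchIn v w , k)

  embed-survives : ∀ d → Survives (embed d)
  embed-survives (inj₁ c)       = punchInᵢ≢i b c
  embed-survives (inj₂ (w , _)) = punchInᵢ≢i v w

  embed-injective : Injection embed
  embed-injective {inj₁ c}       {inj₁ c′}       eq = cong inj₁ (punchIn-injective b c c′ (Sum.inj₁-injective eq))
  embed-injective {inj₂ (w , k)} {inj₂ (w′ , _)} eq with vertexDart-injective eq
  ... | pw≡pw′ , refl = cong (λ u → inj₂ (u , k)) (punchIn-injective v w w′ pw≡pw′)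

  embed-σ : ∀ d → embed (σ d) ≡ σ (embed d)
  embed-σ (inj₁ _) = refl
  embed-σ (inj₂ _) = refl

  restrict : (y : D) → .(Survives y) → D′
  restrict (inj₁ c)       s = inj₁ (punchOut {i = b} {j = c} (λ b≡c → ⊥-elim-irr (s (sym b≡c))))
  restrict (inj₂ (w , k)) s = inj₂ (punchOut {i = v} {j = w} (λ v≡w → ⊥-elim-irr (s (sym v≡w))) , k)

  embed-restrict : ∀ y .(s : Survives y) → embed (restrict y s) ≡ y
  embed-restrict (inj₁ c)       s = cong inj₁ (punchIn-punchOut _)
  embed-restrict (inj₂ (w , k)) s = cong (λ u → inj₂ (u , k)) (punchIn-punchOut _)

  restrict-embed : ∀ d .(s : Survives (embed d)) → restrict (embed d) s ≡ d
  restrict-embed d s = embed-injective (embed-restrict (embed d) s)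

  ¬Image-removed : ∀ {y} → ¬ Survives y → ¬ Image embed y
  ¬Image-removed ¬s (d , embed-d≡y) = ¬s (subst Survives embed-d≡y (embed-survives d))

  merge : D → D
  merge y with y ≟ᴰ v₁ | y ≟ᴰ v₂
  ... | yes _ | _     = a₂
  ... | no  _ | yes _ = a₁
  ... | no  _ | no  _ = y

  merge-cases : ∀ y → (y ≡ v₁ × merge y ≡ a₂) ⊎ (y ≡ v₂ × merge y ≡ a₁) ⊎
                      (y ≢ v₁ × y ≢ v₂ × merge y ≡ y)
  merge-cases y with y ≟ᴰ v₁ | y ≟ᴰ v₂
  ... | yes y≡v₁ | _        = inj₁ (y≡v₁ , refl)
  ... | no  y≢v₁ | yes y≡v₂ = inj₂ (inj₁ (y≡v₂ , refl))
  ... | no  y≢v₁ | no  y≢v₂ = inj₂ (inj₂ (y≢v₁ , y≢v₂ , refl))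

  merge-v₁ : merge v₁ ≡ a₂
  merge-v₁ with merge-cases v₁
  ... | inj₁ (_ , eq)               = eq
  ... | inj₂ (inj₁ (v₁≡v₂ , _))     = contradiction v₁≡v₂ v₁≢v₂
  ... | inj₂ (inj₂ (v₁≢v₁ , _ , _)) = contradiction refl v₁≢v₁

  merge-v₂ : merge v₂ ≡ a₁
  merge-v₂ with merge-cases v₂
  ... | inj₁ (v₂≡v₁ , _)            = contradiction (sym v₂≡v₁) v₁≢v₂
  ... | inj₂ (inj₁ (_ , eq))        = eq
  ... | inj₂ (inj₂ (_ , v₂≢v₂ , _)) = contradiction refl v₂≢v₂

  merge-survivor : ∀ {y} → Survives y → merge y ≡ y
  merge-survivor {y} s with merge-cases y
  ... | inj₁ (refl , _)          = contradiction s (¬survives-v (rot i))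
  ... | inj₂ (inj₁ (refl , _))   = contradiction s (¬survives-v (rot (rot i)))
  ... | inj₂ (inj₂ (_ , _ , eq)) = eq

  survives-merge-α : ∀ {y} → Survives y → Survives (merge (α y))
  survives-merge-α {y} s with merge-cases (α y)
  ... | inj₁ (_ , eq)                = subst Survives (sym eq) survives-a₂
  ... | inj₂ (inj₁ (_ , eq))         = subst Survives (sym eq) survives-a₁
  ... | inj₂ (inj₂ (≢v₁ , ≢v₂ , eq)) =
    subst Survives (sym eq) (survives-other (α-survivor≢bd s) (α-survivor≢vd s) ≢v₁ ≢v₂)

  α′ : D′ → D′
  α′ d = restrict (merge (α (embed d))) (survives-merge-α (embed-survives d))

  embed-α′ : ∀ d → embed (α′ d) ≡ merge (α (embed d))
  embed-α′ d = embed-restrict _ _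

  α′-invol : ∀ d → α′ (α′ d) ≡ d
  α′-invol d = embed-injective (begin
    embed (α′ (α′ d))              ≡⟨ embed-α′ (α′ d) ⟩
    merge (α (embed (α′ d)))       ≡⟨ cong (merge ∘ α) (embed-α′ d) ⟩
    merge (α (merge (α (embed d)))) ≡⟨ back (merge-cases (α (embed d))) ⟩
    embed d                        ∎)
    where
    open ≡-Reasoning
    x = embed d
    back : _ → merge (α (merge (α x))) ≡ x
    back (inj₁ (αx≡v₁ , eq)) =
      trans (cong (merge ∘ α) eq) (trans (cong merge (α-invol v₂)) (trans merge-v₂ (sym (α-swap αx≡v₁))))
    back (inj₂ (inj₁ (αx≡v₂ , eq))) =
      trans (cong (merge ∘ α) eq) (trans (cong merge (α-invol v₁)) (trans merge-v₁ (sym (α-swap αx≡v₂))))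
    back (inj₂ (inj₂ (_ , _ , eq))) =
      trans (cong (merge ∘ α) eq) (trans (cong merge (α-invol x)) (merge-survivor (embed-survives d)))

  α′-nofix : ∀ d → α′ d ≢ d
  α′-nofix d α′d≡d with merge-cases (α (embed d)) | trans (sym (embed-α′ d)) (cong embed α′d≡d)
  ... | inj₁ (αx≡v₁ , eq) | merge≡x =
    v₁≢v₂ (trans (sym αx≡v₁) (trans (cong α (trans (sym merge≡x) eq)) (α-invol v₂)))
  ... | inj₂ (inj₁ (αx≡v₂ , eq)) | merge≡x =
    v₁≢v₂ (sym (trans (sym αx≡v₂) (trans (cong α (trans (sym merge≡x) eq)) (α-invol v₁))))
  ... | inj₂ (inj₂ (_ , _ , eq)) | merge≡x = α-nofix (embed d) (trans (sym eq) merge≡x)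

  embed-α′-bypass : ∀ d → Bypass α v (rot i) (rot (rot i)) (α (embed d)) (embed (α′ d))
  embed-α′-bypass d with merge-cases (α (embed d))
  ... | inj₁ (≡v₁ , eq)               = inj₁ (≡v₁ , trans (embed-α′ d) eq)
  ... | inj₂ (inj₁ (≡v₂ , eq))        = inj₂ (inj₁ (≡v₂ , trans (embed-α′ d) eq))
  ... | inj₂ (inj₂ (≢v₁ , ≢v₂ , eq))  = inj₂ (inj₂ (≢v₁ , ≢v₂ , trans (embed-α′ d) eq))

  embed-φ′ : ∀ d → FirstReturn (φ α) (Image embed) (embed d) (embed (φ α′ d))
  embed-φ′ d with merge-cases (α (embed d))
  ... | inj₁ (≡v₁ , eq) = firstReturn 2 (s≤s z≤n) φ²≡ avoids
    where
    φ≡v₂ : φ α (embed d) ≡ v₂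
    φ≡v₂ = cong σ ≡v₁
    φ²≡ : iter (φ α) 2 (embed d) ≡ embed (φ α′ d)
    φ²≡ = trans (cong (σ ∘ α) φ≡v₂) (sym (trans (embed-σ (α′ d)) (cong σ (trans (embed-α′ d) eq))))
    avoids : ∀ k → 1 ≤ k → k < 2 → ¬ Image embed (iter (φ α) k (embed d))
    avoids 1 _ _ = subst (¬_ ∘ Image embed) (sym φ≡v₂) (¬Image-removed (¬survives-v (rot (rot i))))
    avoids (suc (suc _)) _ (s≤s (s≤s ()))
  ... | inj₂ (inj₁ (≡v₂ , eq)) = firstReturn 4 (s≤s z≤n) φ⁴≡ avoids
    where
    φ≡vd : φ α (embed d) ≡ vd
    φ≡vd = trans (cong σ ≡v₂) (cong (λ k → inj₂ (v , k)) (rot³ i))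
    φ²≡bd : iter (φ α) 2 (embed d) ≡ bd
    φ²≡bd = trans (cong (φ α) φ≡vd) (cong σ α-vd)
    φ³≡v₁ : iter (φ α) 3 (embed d) ≡ v₁
    φ³≡v₁ = trans (cong (φ α) φ²≡bd) (cong σ tail)
    φ⁴≡ : iter (φ α) 4 (embed d) ≡ embed (φ α′ d)
    φ⁴≡ = trans (cong (φ α) φ³≡v₁) (sym (trans (embed-σ (α′ d)) (cong σ (trans (embed-α′ d) eq))))
    avoids : ∀ k → 1 ≤ k → k < 4 → ¬ Image embed (iter (φ α) k (embed d))
    avoids 1 _ _ = subst (¬_ ∘ Image embed) (sym φ≡vd) (¬Image-removed (¬survives-v i))
    avoids 2 _ _ = subst (¬_ ∘ Image embed) (sym φ²≡bd) (¬Image-removed ¬survives-bd)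
    avoids 3 _ _ = subst (¬_ ∘ Image embed) (sym φ³≡v₁) (¬Image-removed (¬survives-v (rot i)))
    avoids (suc (suc (suc (suc _)))) _ (s≤s (s≤s (s≤s (s≤s ()))))
  ... | inj₂ (inj₂ (_ , _ , eq)) =
    firstReturn-step (sym (trans (embed-σ (α′ d)) (cong σ (trans (embed-α′ d) eq))))

  reaches-survivor : ∀ y → ∃ λ j → Survives (iter (φ α) j y)
  reaches-survivor y with survives? y
  ... | yes s  = 0 , s
  ... | no  ¬s with removed y ¬s
  ... | inj₁ refl               = 2 , subst Survives (sym (cong (φ α ∘ σ) tail)) (survives-σ survives-a₁)
  ... | inj₂ (inj₁ refl)        =
    3 , subst Survives (sym (cong (φ α) (trans (cong (φ α ∘ σ) α-vd) (cong σ tail)))) (survives-σ survives-a₁)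
  ... | inj₂ (inj₂ (inj₁ refl)) = 1 , survives-σ survives-a₁
  ... | inj₂ (inj₂ (inj₂ refl)) = 1 , survives-σ survives-a₂

  private
    a₁′ a₂′ : D′
    a₁′ = restrict a₁ survives-a₁
    a₂′ = restrict a₂ survives-a₂

    α′-a₂′ : α′ a₂′ ≡ a₁′
    α′-a₂′ = embed-injective (trans (embed-α′ a₂′)
      (trans (cong (merge ∘ α) (embed-restrict a₂ _))
      (trans (cong merge (α-invol v₂)) (trans merge-v₂ (sym (embed-restrict a₁ _))))))

    α′-a₁′ : α′ a₁′ ≡ a₂′
    α′-a₁′ = trans (cong α′ (sym α′-a₂′)) (α′-invol a₂′)

  -- Deleted darts are sent to a dart of the merged edge.
  project : D → D′
  project y with survives? y
  ... | yes s = restrict y s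
  ... | no  _ = a₁′

  project-survivor : ∀ {y} .(s : Survives y) → project y ≡ restrict y s
  project-survivor {y} s with survives? y
  ... | yes _  = refl
  ... | no  ¬s = ⊥-elim-irr (¬s s)

  project-removed : ∀ {y} → ¬ Survives y → project y ≡ a₁′
  project-removed {y} ¬s with survives? y
  ... | yes s = contradiction s ¬s
  ... | no  _ = refl

  project-α : ∀ {d} y → Reach α′ d (project y) → Reach α′ d (project (α y))
  project-α {d} y r with survives? y | survives? (α y)
  ... | yes s | yes s′ = subst (Reach α′ d) (embed-injective (begin
      embed (α′ (restrict y s))         ≡⟨ embed-α′ _ ⟩
      merge (α (embed (restrict y s)))  ≡⟨ cong (merge ∘ α) (embed-restrict y s) ⟩
      merge (α y)                       ≡⟨ merge-survivor s′ ⟩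
      α y                               ≡⟨ embed-restrict (α y) s′ ⟨
      embed (restrict (α y) s′)         ∎)) (viaα r)
    where open ≡-Reasoning
  ... | yes s | no ¬s′ with removed (α y) ¬s′
  ...   | inj₁ ≡bd                = contradiction ≡bd (α-survivor≢bd s)
  ...   | inj₂ (inj₁ ≡vd)         = contradiction ≡vd (α-survivor≢vd s)
  ...   | inj₂ (inj₂ (inj₁ ≡v₁)) with refl ← α-swap ≡v₁ = r
  ...   | inj₂ (inj₂ (inj₂ ≡v₂)) with refl ← α-swap ≡v₂ = subst (Reach α′ d) α′-a₂′ (viaα r)
  project-α {d} y r | no ¬s | yes s′ with removed y ¬s
  ...   | inj₁ refl               = contradiction (subst Survives tail s′) (¬survives-v i)
  ...   | inj₂ (inj₁ refl)        = contradiction (subst Survives α-vd s′) ¬survives-bd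
  ...   | inj₂ (inj₂ (inj₁ refl)) = r
  ...   | inj₂ (inj₂ (inj₂ refl)) = subst (Reach α′ d) α′-a₁′ (viaα r)
  project-α y r | no _ | no _ = r

  project-σ : ∀ {d} y → Reach α′ d (project y) → Reach α′ d (project (σ y))
  project-σ {d} y r with survives? y
  ... | yes s  = subst (Reach α′ d) (trans (embed-injective (trans (embed-σ (restrict y s))
                   (trans (cong σ (embed-restrict y s)) (sym (embed-restrict (σ y) (survives-σ s))))))
                   (sym (project-survivor (survives-σ s)))) (viaσ r)
  ... | no  ¬s = subst (Reach α′ d) (sym (project-removed {σ y} (¬s ∘ survives-σ⁻))) r

  reach-project : ∀ d {y} → Reach α (embed d) y → Reach α′ d (project y)
  reach-project d here =
    subst (Reach α′ d) (sym (trans (project-survivor {embed d} (embed-survives d)) (restrict-embed d _))) here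
  reach-project d (viaα {e = y} r) = project-α y (reach-project d r)
  reach-project d (viaσ {e = y} r) = project-σ y (reach-project d r)

  α′-connected : (∀ x y → Reach α x y) → ∀ d e → Reach α′ d e
  α′-connected connected d e = subst (Reach α′ d)
    (trans (project-survivor {embed e} (embed-survives e)) (restrict-embed e _)) (reach-project d (connected (embed d) (embed e)))

  private
    N : ℕ
    N = n + 3 * m

    darts≡ : suc n + 3 * suc m ≡ 4 + N
    darts≡ = shuffle n m
      where
      shuffle : ∀ n m → suc n + 3 * suc m ≡ 4 + (n + 3 * m)
      shuffle = solve-∀

    E : D → Fin (4 + N)
    E = cast darts≡ ∘ dartIndex

    f₀ : Fin (4 + N) → Fin (4 + N)
    f₀ = cast darts≡ ∘ faceMap α ∘ cast (sym darts≡)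

    E-injective : Injection E
    E-injective eq = dartIndex-injective {suc n} {suc m}
      (trans (sym (cast-involutive (sym darts≡) darts≡ _))
             (trans (cong (cast (sym darts≡)) eq) (cast-involutive (sym darts≡) darts≡ _)))

    E⁻¹ : Fin (4 + N) → D
    E⁻¹ = indexDart ∘ cast (sym darts≡)

    E-indexDart : ∀ z → E (E⁻¹ z) ≡ z
    E-indexDart z = trans (cong (cast darts≡) (dartIndex-indexDart {suc n} {suc m} (cast (sym darts≡) z)))
                          (cast-involutive darts≡ (sym darts≡) z)

    toℕ-E : ∀ d → toℕ (E d) ≡ dartRank d
    toℕ-E d = trans (toℕ-cast darts≡ (dartIndex d)) (toℕ-dartIndex d)

    f₀-E : ∀ d → f₀ (E d) ≡ E (φ α d)
    f₀-E d = cong (E ∘ φ α) (trans (cong indexDart (cast-involutive (sym darts≡) darts≡ (dartIndex d))) (indexDart-dartIndex d))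

    iter-f₀-E : ∀ k d → iter f₀ k (E d) ≡ E (iter (φ α) k d)
    iter-f₀-E zero    d = refl
    iter-f₀-E (suc k) d = trans (cong f₀ (iter-f₀-E k d)) (f₀-E _)

    f₀-injective : Injection f₀
    f₀-injective {z} {z′} eq = trans (sym (E-indexDart z)) (trans (cong E (α-injective (σ-injective
      (E-injective (trans (sym (f₀-E (E⁻¹ z))) (trans (cong f₀ (E-indexDart z))
        (trans eq (trans (cong f₀ (sym (E-indexDart z′))) (f₀-E (E⁻¹ z′))))))))))
      (E-indexDart z′))
      where
      α-injective : Injection α
      α-injective {x} {y} αx≡αy = trans (α-swap αx≡αy) (α-invol y)

    -- Under E the deleted darts sit at positions b and B, B + 1, B + 2. Deleting them from the top
    -- down, H₄ sends the index of each dart of the new graph to the position of its copy (E-embed).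
    B : ℕ
    B = suc n + 3 * toℕ v

    B+j< : ∀ j → B + j < suc (suc j) + N
    B+j< j = ≤-trans (s≤s (+-monoˡ-≤ j (+-monoʳ-≤ (suc n) (*-monoʳ-≤ 3 (s≤s⁻¹ (toℕ<n v))))))
                     (≤-reflexive (shuffle n m j))
      where
      shuffle : ∀ n m j → suc (suc n + 3 * m + j) ≡ suc (suc j) + (n + 3 * m)
      shuffle = solve-∀

    x₁ : Fin (4 + N)
    x₁ = fromℕ< (B+j< 2)
    x₂ : Fin (3 + N)
    x₂ = fromℕ< (B+j< 1)
    x₃ : Fin (2 + N)
    x₃ = fromℕ< (B+j< 0)
    b<1+N : toℕ b < 1 + N
    b<1+N = s≤s (≤-trans (s≤s⁻¹ (toℕ<n b)) (m≤m+n n (3 * m)))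

    x₄ : Fin (1 + N)
    x₄ = fromℕ< b<1+N

    H₃ : Fin (1 + N) → Fin (4 + N)
    H₃ = punchIn x₁ ∘ punchIn x₂ ∘ punchIn x₃

    H₄ : Fin N → Fin (4 + N)
    H₄ = H₃ ∘ punchIn x₄

    H₃-low : ∀ y → toℕ y < B → toℕ (H₃ y) ≡ toℕ y
    H₃-low y y<B = trans e₁ (trans e₂ e₃)
      where
      e₃ = toℕ-punchIn-< x₃ y (subst (toℕ y <_) (sym (trans (toℕ-fromℕ< (B+j< 0)) (+-identityʳ B))) y<B)
      e₂ = toℕ-punchIn-< x₂ _ (subst₂ _<_ (sym e₃) (sym (toℕ-fromℕ< (B+j< 1))) (≤-trans y<B (m≤m+n B 1)))
      e₁ = toℕ-punchIn-< x₁ _ (subst₂ _<_ (sym (trans e₂ e₃)) (sym (toℕ-fromℕ< (B+j< 2))) (≤-trans y<B (m≤m+n B 2)))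

    H₃-high : ∀ y → B ≤ toℕ y → toℕ (H₃ y) ≡ 3 + toℕ y
    H₃-high y B≤y = trans e₁ (cong suc (trans e₂ (cong suc e₃)))
      where
      e₃ = toℕ-punchIn-≥ x₃ y (subst (_≤ toℕ y) (sym (trans (toℕ-fromℕ< (B+j< 0)) (+-identityʳ B))) B≤y)
      e₂ = toℕ-punchIn-≥ x₂ _ (subst₂ _≤_ (sym (trans (toℕ-fromℕ< (B+j< 1)) (+-comm B 1))) (sym e₃) (s≤s B≤y))
      e₁ = toℕ-punchIn-≥ x₁ _ (subst₂ _≤_ (sym (trans (toℕ-fromℕ< (B+j< 2)) (+-comm B 2)))
                                           (sym (trans e₂ (cong suc e₃))) (s≤s (s≤s B≤y)))

    x₄-interior : ∀ w j → toℕ (punchIn x₄ (dartIndex {n} {m} (inj₂ (w , j)))) ≡ suc (n + slotRank (w , j))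
    x₄-interior w j = trans (toℕ-punchIn-≥ x₄ _ (subst₂ _≤_ (sym (toℕ-fromℕ< b<1+N)) (sym rank≡)
                                                          (≤-trans (s≤s⁻¹ (toℕ<n b)) (m≤m+n n _))))
                            (cong suc rank≡)
      where rank≡ = toℕ-dartIndex {n} {m} (inj₂ (w , j))

    slot≤2 : ∀ (j : Fin 3) → toℕ j ≤ 2
    slot≤2 j = s≤s⁻¹ (toℕ<n j)

    E-embed : ∀ d → E (embed d) ≡ H₄ (dartIndex d)
    E-embed (inj₁ c) = toℕ-injective (trans (toℕ-E (embed (inj₁ c)))
                                           (sym (trans (H₃-low _ (subst (_< B) (sym x₄-c) c′<B)) x₄-c)))
      where
      x₄-c : toℕ (punchIn x₄ (dartIndex {n} {m} (inj₁ c))) ≡ toℕ (punchIn b c)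
      x₄-c = toℕ-punchIn-cong x₄ b _ c (toℕ-fromℕ< b<1+N) (toℕ-dartIndex {n} {m} (inj₁ c))
      c′<B : toℕ (punchIn b c) < B
      c′<B = ≤-trans (toℕ<n (punchIn b c)) (m≤m+n (suc n) _)
    E-embed (inj₂ (w , j)) with toℕ w <? toℕ v
    ... | yes w<v = toℕ-injective (trans (toℕ-E (embed (inj₂ (w , j))))
                                         (sym (trans (H₃-low _ (subst (_< B) (sym x₄-d) below)) (trans x₄-d rank≡))))
      where
      x₄-d = x₄-interior w j
      below : suc (n + slotRank (w , j)) < B
      below = s≤s (+-monoʳ-< n (≤-trans (s≤s (+-monoʳ-≤ (3 * toℕ w) (slot≤2 j)))
                               (≤-trans (≤-reflexive (slot-bound (toℕ w))) (*-monoʳ-≤ 3 w<v))))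
        where
        slot-bound : ∀ w → suc (3 * w + 2) ≡ 3 * suc w
        slot-bound = solve-∀
      rank≡ : suc (n + slotRank (w , j)) ≡ dartRank (embed (inj₂ (w , j)))
      rank≡ = cong (λ u → suc (n + (3 * u + toℕ j))) (sym (toℕ-punchIn-< v w w<v))
    ... | no  w≮v = toℕ-injective (trans (toℕ-E (embed (inj₂ (w , j))))
                      (sym (trans (H₃-high _ (subst (B ≤_) (sym x₄-d) above)) (trans (cong (3 +_) x₄-d) rank≡))))
      where
      x₄-d = x₄-interior w j
      above : B ≤ suc (n + slotRank (w , j))
      above = s≤s (+-monoʳ-≤ n (≤-trans (*-monoʳ-≤ 3 (≮⇒≥ w≮v)) (m≤m+n _ _)))
      rank≡ : 3 + suc (n + slotRank (w , j)) ≡ dartRank (embed (inj₂ (w , j)))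
      rank≡ = trans (shift n (toℕ w) (toℕ j))
                    (cong (λ u → suc n + (3 * u + toℕ j)) (sym (toℕ-punchIn-≥ v w (≮⇒≥ w≮v))))
        where
        shift : ∀ n w j → 3 + suc (n + (3 * w + j)) ≡ suc n + (3 * suc w + j)
        shift = solve-∀


    reach-image : ∀ z → ∃ λ j → Image H₄ (iter f₀ j z)
    reach-image z with reaches-survivor (E⁻¹ z)
    ... | j , s = j , dartIndex (restrict _ s) , (begin
      H₄ (dartIndex (restrict _ s))  ≡⟨ E-embed (restrict _ s) ⟨
      E (embed (restrict _ s))       ≡⟨ cong E (embed-restrict _ s) ⟩
      E (iter (φ α) j (E⁻¹ z))       ≡⟨ iter-f₀-E j (E⁻¹ z) ⟨
      iter f₀ j (E (E⁻¹ z))          ≡⟨ cong (iter f₀ j) (E-indexDart z) ⟩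
      iter f₀ j z                    ∎)
      where open ≡-Reasoning

    meets : ∀ {M} (K : Fin N → Fin M) (H : Fin M → Fin (4 + N)) → H₄ ≗ H ∘ K →
            ∀ z → ∃ λ j → Image H (iter f₀ j z)
    meets K H H₄≗H∘K z = let j , w , eq = reach-image z in j , K w , trans (sym (H₄≗H∘K w)) eq

    induced₁ : Induced f₀ (3 + N)
    induced₁ = induced-delete (induced-self f₀-injective) x₁ (meets (punchIn x₂ ∘ punchIn x₃ ∘ punchIn x₄) _ λ _ → refl)

    induced₂ : Induced f₀ (2 + N)
    induced₂ = induced-delete induced₁ x₂ (meets (punchIn x₃ ∘ punchIn x₄) _ λ _ → refl)

    induced₃ : Induced f₀ (1 + N)
    induced₃ = induced-delete induced₂ x₃ (meets (punchIn x₄) _ λ _ → refl)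

    induced₄ : Induced f₀ N
    induced₄ = induced-delete induced₃ x₄ (meets id _ λ _ → refl)

    returns-φ′ : ∀ y → FirstReturn f₀ (Image H₄) (H₄ y) (H₄ (faceMap α′ y))
    returns-φ′ y = subst₂ (FirstReturn f₀ (Image H₄)) (E-embed-index y) (E-embed (φ α′ (indexDart y)))
                          (firstReturn-map E iter-f₀-E reflect (embed-φ′ (indexDart y)))
      where
      E-embed-index : ∀ y → E (embed (indexDart y)) ≡ H₄ y
      E-embed-index y = trans (E-embed (indexDart y)) (cong H₄ (dartIndex-indexDart {n} {m} y))
      reflect : ∀ {a} → Image H₄ (E a) → Image embed a
      reflect (z , H₄z≡Ea) = indexDart z , E-injective (trans (E-embed-index z) H₄z≡Ea)

    induced₄≗faceMap : Induced.f induced₄ ≗ faceMap α′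
    induced₄≗faceMap y = Induced.H-inj induced₄
      (firstReturn-unique {P = Image H₄} (Induced.f induced₄ y , refl) (faceMap α′ y , refl)
                          returns₄ (returns-φ′ y))
      where
      returns₄ : FirstReturn f₀ (Image H₄) (H₄ y) (H₄ (Induced.f induced₄ y))
      returns₄ = Induced.returns induced₄ y

  numFaces-α′ : numFaces α′ ≡ numFaces α
  numFaces-α′ = begin
    numFaces α′                                ≡⟨ numFaces≡numCycles α′ ⟩
    numCycles N (faceMap α′)                   ≡⟨ numCycles-cong N induced₄≗faceMap ⟨
    numCycles N (Induced.f induced₄)           ≡⟨ Induced.count induced₄ ⟩
    numCycles (4 + N) f₀                       ≡⟨ numCycles-cast darts≡ (faceMap α) ⟨
    numCycles (suc n + 3 * suc m) (faceMap α)  ≡⟨ numFaces≡numCycles α ⟨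
    numFaces α                                 ∎
    where open ≡-Reasoning

  private
    module Φ = FirstReturnMap embed-injective embed-φ′

    interior-embed : ∀ d → IsInterior (embed d) → IsInterior d
    interior-embed (inj₂ _) _ = tt

    interior-visited : ∀ {J c k} → (∀ j → 1 ≤ j → j < J → IsInterior (iter (φ α) j (inj₁ (punchIn b c)))) →
                       Φ.Visited J (inj₁ c) k → ∀ j → 1 ≤ j → j < k → IsInterior (iter (φ α′) j (inj₁ c))
    interior-visited interior visited j j≥1 j<k with visited j j≥1 j<k
    ... | j′ , j′≥1 , j′<J , eq = interior-embed _ (subst IsInterior (sym eq) (interior j′ j′≥1 j′<J))

  boundaryOrder′ : BoundaryOrder α → BoundaryOrder α′
  boundaryOrder′ order c c′ c→c′ with CycSucc-punchIn n b c c′ c→c′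
  ... | inj₁ pc→pc′ with order _ _ pc→pc′
  ...   | J , J≥1 , φᴶ≡ , interior with Φ.returns-to J (inj₁ c) J≥1 φᴶ≡
  ...     | k , k≥1 , φ′ᵏ≡ , visited = k , k≥1 , φ′ᵏ≡ , interior-visited interior visited
  boundaryOrder′ order c c′ c→c′ | inj₂ (pc→b , b→pc′) with order _ _ pc→b | order _ _ b→pc′
  ... | J₁ , J₁≥1 , φᴶ¹≡ , interior₁ | J₂ , J₂≥1 , φᴶ²≡ , interior₂
    with Φ.returns-to (J₂ + J₁) (inj₁ c) (≤-trans J₂≥1 (m≤m+n J₂ J₁)) φᴶ²⁺ᴶ¹≡
    where
    φᴶ²⁺ᴶ¹≡ : iter (φ α) (J₂ + J₁) (inj₁ (punchIn b c)) ≡ inj₁ (punchIn b c′)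
    φᴶ²⁺ᴶ¹≡ = trans (iter-+ (φ α) J₂ J₁ _) (trans (cong (iter (φ α) J₂) φᴶ¹≡) φᴶ²≡)
  ... | k , k≥1 , φ′ᵏ≡ , visited = k , k≥1 , φ′ᵏ≡ , visited′
    where
    -- In G the walk from c to c′ meets the deleted boundary dart b after J₁ steps.
    visited′ : ∀ j → 1 ≤ j → j < k → IsInterior (iter (φ α′) j (inj₁ c))
    visited′ j j≥1 j<k with visited j j≥1 j<k
    ... | j′ , j′≥1 , j′<J , eq with <-cmp j′ J₁
    ...   | tri< j′<J₁ _ _ = interior-embed _ (subst IsInterior (sym eq) (interior₁ j′ j′≥1 j′<J₁))
    ...   | tri≈ _ refl _ = contradiction (_ , trans eq φᴶ¹≡) (¬Image-removed ¬survives-bd)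
    ...   | tri> _ _ j′>J₁ = interior-embed _ (subst IsInterior (sym (trans eq (iter-∸ (φ α) _ (<⇒≤ j′>J₁))))
      (subst (λ z → IsInterior (iter (φ α) (j′ ∸ J₁) z)) (sym φᴶ¹≡)
        (interior₂ (j′ ∸ J₁) (m<n⇒0<n∸m j′>J₁)
                   (subst (j′ ∸ J₁ <_) (m+n∸n≡m J₂ J₁) (∸-monoˡ-< j′<J (<⇒≤ j′>J₁))))))

  planar′ : Planar α → Planar α′
  planar′ planar = euler-tailRemoval n m (numFaces α′)
    (subst (λ F → 2 * (suc n + suc m) + 2 * F ≡ 4 + (suc n + 3 * suc m)) (sym numFaces-α′) planar)

  tailStep : ∀ col connected planar order →
             TailStep (plabic col α α-invol α-nofix connected planar order)
                      (plabic (col ∘ punchIn v) α′ α′-invol α′-nofix (α′-connected connected)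
                              (planar′ planar) (boundaryOrder′ order))
  tailStep col connected planar order = record
    { b = b ; v = v ; i = i ; tail = tail ; noLoop = noLoop
    ; g = embed
    ; g-inj = λ _ _ → embed-injective
    ; g-avoid-b = λ d eq → ¬survives-bd (subst Survives eq (embed-survives d))
    ; g-avoid-v = λ d k eq → ¬survives-v k (subst Survives eq (embed-survives d))
    ; g-surj = λ e e≢bd e≢v → restrict e (s e≢bd e≢v) , embed-restrict e (s e≢bd e≢v)
    ; g-bdry = λ c → punchIn b c , refl , toℕ-punchIn b c
    ; g-σ = embed-σ
    ; g-col = λ _ _ _ _ eq → cong col (proj₁ (vertexDart-injective eq))
    ; g-α = embed-α′-bypass
    }
    where
    s : ∀ {e} → e ≢ bd → (∀ k → e ≢ inj₂ (v , k)) → Survives e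
    s e≢bd e≢v = survives-other e≢bd (e≢v i) (e≢v (rot i)) (e≢v (rot (rot i)))

-- Terminal graphs

module Components {nB nI : ℕ} {α : Dart nB nI → Dart nB nI} (α-invol : ∀ d → α (α d) ≡ d)
                  (connected : ∀ d e → Reach α d e) where

  everywhere : (P : Dart nB nI → Set) → (∀ {y} → P y → P (α y)) → (∀ {y} → P y → P (σ y)) →
               ∀ {x} → P x → ∀ y → P y
  everywhere P closed-α closed-σ {x} Px y = go (connected x y)
    where
    go : ∀ {y} → Reach α x y → P y
    go here     = Px
    go (viaα r) = closed-α (go r)
    go (viaσ r) = closed-σ (go r)

  module _ {b c : Fin nB} (edge : α (inj₁ b) ≡ inj₁ c) where

    OnEdge : Dart nB nI → Set
    OnEdge y = y ≡ inj₁ b ⊎ y ≡ inj₁ c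

    onEdge : ∀ y → OnEdge y
    onEdge = everywhere OnEdge closed-α closed-σ (inj₁ refl)
      where
      closed-α : ∀ {y} → OnEdge y → OnEdge (α y)
      closed-α (inj₁ refl) = inj₂ edge
      closed-α (inj₂ refl) = inj₁ (trans (cong α (sym edge)) (α-invol _))
      closed-σ : ∀ {y} → OnEdge y → OnEdge (σ y)
      closed-σ (inj₁ refl) = inj₁ refl
      closed-σ (inj₂ refl) = inj₂ refl

  module _ {b : Fin nB} {v : Fin nI} {i : Fin 3} (edge : α (inj₁ b) ≡ inj₂ (v , i))
           (loop : α (inj₂ (v , rot i)) ≡ inj₂ (v , rot (rot i))) where

    OnLollipop : Dart nB nI → Set
    OnLollipop y = y ≡ inj₁ b ⊎ ∃ λ k → y ≡ inj₂ (v , k)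

    onLollipop : ∀ y → OnLollipop y
    onLollipop = everywhere OnLollipop closed-α closed-σ (inj₁ refl)
      where
      closed-α : ∀ {y} → OnLollipop y → OnLollipop (α y)
      closed-α (inj₁ refl) = inj₂ (i , edge)
      closed-α (inj₂ (k , refl)) with rot-orbit i k
      ... | inj₁ refl        = inj₁ (trans (cong α (sym edge)) (α-invol _))
      ... | inj₂ (inj₁ refl) = inj₂ (rot (rot i) , loop)
      ... | inj₂ (inj₂ refl) = inj₂ (rot i , trans (cong α (sym loop)) (α-invol _))
      closed-σ : ∀ {y} → OnLollipop y → OnLollipop (σ y)
      closed-σ (inj₁ refl)       = inj₁ refl
      closed-σ (inj₂ (k , refl)) = inj₂ (rot k , refl)

data Terminal (H : PlabicGraph) : Set where
  single-edge : SingleEdge H → Terminal H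
  lollipop    : Lollipop H → Terminal H
  no-boundary : NoBoundary H → Terminal H

Reduced : PlabicGraph → Set
Reduced G = Σ PlabicGraph λ H → TailRemovals G H × Terminal H × interiorFaces H ≡ interiorFaces G

single-edge-terminal : ∀ {n nI} {α : Dart (suc n) nI → Dart (suc n) nI} (α-invol : ∀ d → α (α d) ≡ d) →
                       (∀ d → α d ≢ d) → (∀ d e → Reach α d e) → ∀ {c} → α (inj₁ zero) ≡ inj₁ c →
                       (suc n ≡ 2) × (nI ≡ 0) × (∀ c′ → ∃ λ c″ → α (inj₁ c′) ≡ inj₁ c″)
single-edge-terminal {n} {nI} {α} α-invol α-nofix connected {c} edge =
  Fin-pair c c≢0 boundary , fin-empty , partner
  where
  open Components α-invol connected
  c≢0 : c ≢ zero
  c≢0 refl = α-nofix _ edge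
  boundary : ∀ y → y ≡ zero ⊎ y ≡ c
  boundary y with onEdge edge (inj₁ y)
  ... | inj₁ refl = inj₁ refl
  ... | inj₂ refl = inj₂ refl
  fin-empty : nI ≡ 0
  fin-empty = Fin-empty λ w → not-vertex (onEdge edge (inj₂ (w , zero)))
    where
    not-vertex : ∀ {w} → OnEdge edge (inj₂ (w , zero)) → ⊥
    not-vertex (inj₁ ())
    not-vertex (inj₂ ())
  partner : ∀ c′ → ∃ λ c″ → α (inj₁ c′) ≡ inj₁ c″
  partner c′ with onEdge edge (inj₁ c′)
  ... | inj₁ refl = c , edge
  ... | inj₂ refl = zero , trans (cong α (sym edge)) (α-invol _)

lollipop-terminal : ∀ {n nI} {α : Dart (suc n) nI → Dart (suc n) nI} (α-invol : ∀ d → α (α d) ≡ d) →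
                    (∀ d e → Reach α d e) → ∀ {v i} → α (inj₁ zero) ≡ inj₂ (v , i) →
                    α (inj₂ (v , rot i)) ≡ inj₂ (v , rot (rot i)) →
                    (suc n ≡ 1) × (nI ≡ 1) ×
                    (∀ c → ∃ λ w → ∃ λ j → (α (inj₁ c) ≡ inj₂ (w , j)) ×
                                            (α (inj₂ (w , rot j)) ≡ inj₂ (w , rot (rot j))))
lollipop-terminal {α = α} α-invol connected {v} {i} edge loop =
  Fin-singleton zero boundary , Fin-singleton v vertex ,
  λ c → v , i , subst (λ c → α (inj₁ c) ≡ _) (sym (boundary c)) edge , loop
  where
  open Components α-invol connected
  boundary : ∀ c → c ≡ zero
  boundary c with onLollipop edge loop (inj₁ c)
  ... | inj₁ refl = refl
  vertex : ∀ w → w ≡ v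
  vertex w with onLollipop edge loop (inj₂ (w , zero))
  ... | inj₂ (_ , refl) = refl

interiorFaces-single-edge : ∀ H → SingleEdge H → interiorFaces H ≡ 0
interiorFaces-single-edge record { nB = .2 ; nI = .0 ; α = α ; planar = planar } (refl , refl , _) =
  cong (_∸ 1) (*-cancelˡ-≡ (numFaces α) 1 2 (+-cancelˡ-≡ 4 _ _ planar))

interiorFaces-lollipop : ∀ H → Lollipop H → interiorFaces H ≡ 1
interiorFaces-lollipop record { nB = .1 ; nI = .1 ; α = α ; planar = planar } (refl , refl , _) =
  cong (_∸ 1) (*-cancelˡ-≡ (numFaces α) 2 2 (+-cancelˡ-≡ 4 _ _ planar))

interiorFaces-no-boundary : ∀ H → NoBoundary H → 2 ≤ interiorFaces H
interiorFaces-no-boundary record { nB = .0 ; nI = zero  ; planar = () } refl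
interiorFaces-no-boundary record { nB = .0 ; nI = suc k ; α = α ; planar = planar } refl =
  ∸-monoˡ-≤ 1 (three≤faces (numFaces α) planar)
  where
  three≤faces : ∀ F → 2 * suc k + 2 * F ≡ 4 + 3 * suc k → 3 ≤ F
  three≤faces F euler with F ≤? 2
  ... | no  F≰2 = ≰⇒> F≰2
  ... | yes F≤2 = contradiction (*-monoʳ-≤ 2 F≤2) (<⇒≱ (≤-trans (m≤m+n 5 k) (≤-reflexive (sym 2F≡5+k))))
    where
    rearrange : ∀ k → 4 + 3 * suc k ≡ 2 * suc k + (5 + k)
    rearrange = solve-∀
    2F≡5+k : 2 * F ≡ 5 + k
    2F≡5+k = +-cancelˡ-≡ (2 * suc k) _ _ (trans euler (rearrange k))

reduce : ∀ {nB nI} (col : Fin nI → Colour) (α : Dart nB nI → Dart nB nI) (α-invol : ∀ d → α (α d) ≡ d)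
         (α-nofix : ∀ d → α d ≢ d) (connected : ∀ d e → Reach α d e) (planar : Planar α) (order : BoundaryOrder α) →
         Reduced (plabic col α α-invol α-nofix connected planar order)
reduce {zero} col α α-invol α-nofix connected planar order = _ , ε , no-boundary refl , refl
reduce {suc n} {zero} col α α-invol α-nofix connected planar order with α (inj₁ zero) in edge
... | inj₁ c = _ , ε , single-edge (single-edge-terminal α-invol α-nofix connected edge) , refl
... | inj₂ (() , _)
reduce {suc n} {suc m} col α α-invol α-nofix connected planar order with α (inj₁ zero) in edge
... | inj₁ c = _ , ε , single-edge (single-edge-terminal α-invol α-nofix connected edge) , refl
... | inj₂ (v , i) with α (inj₂ (v , rot i)) ≟ᴰ inj₂ (v , rot (rot i))
...   | yes loop = _ , ε , lollipop (lollipop-terminal α-invol connected edge loop) , refl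
...   | no noLoop =
  let H , removals , terminal , same = reduce (col ∘ punchIn v) α′ α′-invol α′-nofix (α′-connected connected)
                                              (planar′ planar) (boundaryOrder′ order)
  in H , tailStep col connected planar order ◅ removals , terminal , trans same (cong (_∸ 1) numFaces-α′)
  where open TailRemoval α-invol α-nofix edge noLoop

proposition6p1 : (G : PlabicGraph) →
    ((interiorFaces G ≡ 0) → Σ PlabicGraph λ H → TailRemovals G H × SingleEdge H) ×
    ((interiorFaces G ≡ 1) → Σ PlabicGraph λ H → TailRemovals G H × Lollipop H) ×
    ((2 ≤ interiorFaces G) → Σ PlabicGraph λ H → TailRemovals G H × NoBoundary H)
proposition6p1 G with reduce (col G) (α G) (α-invol G) (α-nofix G) (connected G) (planar G) (boundaryOrder G)
... | H , G↝H , single-edge edge , same =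
  (λ _ → H , G↝H , edge) ,
  (λ ≡1 → contradiction (trans (sym ≡0) ≡1) 0≢1+n) ,
  (λ 2≤ → contradiction (subst (2 ≤_) ≡0 2≤) λ ())
  where ≡0 = trans (sym same) (interiorFaces-single-edge H edge)
... | H , G↝H , lollipop loop , same =
  (λ ≡0 → contradiction (trans (sym ≡0) ≡1) 0≢1+n) ,
  (λ _ → H , G↝H , loop) ,
  (λ 2≤ → contradiction (subst (2 ≤_) ≡1 2≤) λ { (s≤s ()) })
  where ≡1 = trans (sym same) (interiorFaces-lollipop H loop)
... | H , G↝H , no-boundary none , same =
  (λ ≡0 → contradiction (subst (2 ≤_) ≡0 2≤) λ ()) ,
  (λ ≡1 → contradiction (subst (2 ≤_) ≡1 2≤) λ { (s≤s ()) }) ,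
  (λ _ → H , G↝H , none)
  where 2≤ = subst (2 ≤_) same (interiorFaces-no-boundary H none)
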